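{- Let $w\in S_n$ and let $(a,b)$ be a lower outside corner of $D(w)$, with $y=z_{a,b}$. Write the Fulton generators of $I_w$ as $\{yq_1+r_1,\ldots,yq_k+r_k,h_1,\ldots,h_\ell\}$, where no term of any $q_i$, $r_i$ or $h_j$ is divisible by $y$. If $N=(h_1,\ldots,h_\ell)$, then $N=I_v$ for $v=wt_{a,w^{ -1}(b)}$. Furthermore, every Fulton generator of $I_v$ equals $h_i$ for some $i\in[\ell]$.
   Context: $R=\kappa[z_{i,j}:i,j\in[n]]$, $Z=(z_{i,j})$. For $w\in S_n$: $wt_{i,j}$ is $w$ with entries in positions $i,j$ swapped; ${\tt rk}_w(a,b)=\#\{i\le a:w(i)\le b\}$; $D(w)=\{(i,j):w(i)>j,\ w^{ -1}(j)>i\}$; ${\tt Ess}(w)=\{(i,j)\in D(w):(i+1,j),(i,j+1)\notin D(w)\}$; a lower outside corner of $D(w)$ is $(a,b)\in D(w)$ with no other $(c,d)\in D(w)$ having $c\ge a,d\ge b$. $I_w=\sum_{i,j}I_{{\tt rk}_w(i,j)+1}(Z_{[i],[j]})$ ($Z_{[i],[j]}$ northwest $i\times j$ submatrix, $I_k$ ideal of $k$-minors); the Fulton generators of $I_w$ are the $({\tt rk}_w(i,j)+1)$-minors of $Z_{[i],[j]}$ for $(i,j)\in{\tt Ess}(w)$. -}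

module Defs where

open import Level using (Level; _⊔_)
open import Algebra.Bundles using (CommutativeRing)
open import Data.Nat as ℕ using (ℕ; zero; suc; _≤_; _<_)
open import Data.Fin as Fin using (Fin; toℕ; punchIn)
open import Data.Fin.Permutation using (Permutation′; _⟨$⟩ʳ_; _⟨$⟩ˡ_; transpose; _∘ₚ_)
open import Data.Fin.Properties using (all?)
open import Data.List using (List; []; _∷_; _++_; map; concatMap; foldr; filter; length)
open import Data.Product using (Σ; ∃; ∃-syntax; _×_; _,_; proj₁; proj₂)
open import Relation.Nullary using (¬_; Dec; yes; no)
open import Relation.Unary using (Pred)
open import Relation.Binary.PropositionalEquality using (_≡_)
import Data.Nat.Properties as ℕP

record Field (c ℓ : Level) : Set (Level.suc (c ⊔ ℓ)) where
  field
    commutativeRing : CommutativeRing c ℓ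
  open CommutativeRing commutativeRing public
  field
    1≉0     : ¬ (1# ≈ 0#)
    inverse : ∀ x → ¬ (x ≈ 0#) → ∃[ y ] (x * y ≈ 1#)

-- Permutation combinatorics (positions and values are 0-based Fin n;
-- the paper's 1-based index i corresponds to toℕ i + 1, and all
-- comparisons are order-preserving, so nothing changes).

module _ {n : ℕ} where

  rk : Permutation′ n → Fin n → Fin n → ℕ
  rk w a b = length (filter (λ i → (toℕ i ℕP.≤? toℕ a) ×-dec (toℕ (w ⟨$⟩ʳ i) ℕP.≤? toℕ b))
                            (Data.List.Base.allFin n))
    where open import Relation.Nullary.Decidable using (_×-dec_)
          import Data.List.Base

  InD : Permutation′ n → Fin n → Fin n → Set
  InD w i j = (toℕ j < toℕ (w ⟨$⟩ʳ i)) × (toℕ i < toℕ (w ⟨$⟩ˡ j))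

  -- Essential set: (i,j) ∈ D(w) with (i+1,j),(i,j+1) ∉ D(w)
  -- (a box outside the n×n grid is not in D(w)).
  InEss : Permutation′ n → Fin n → Fin n → Set
  InEss w i j = InD w i j
              × (∀ i' → toℕ i' ≡ suc (toℕ i) → ¬ InD w i' j)
              × (∀ j' → toℕ j' ≡ suc (toℕ j) → ¬ InD w i j')

  LowerOutsideCorner : Permutation′ n → Fin n → Fin n → Set
  LowerOutsideCorner w a b = InD w a b
    × (∀ c d → InD w c d → toℕ a ≤ toℕ c → toℕ b ≤ toℕ d → (c ≡ a × d ≡ b))

  -- v = w t_{i,j}: w with the entries in positions i and j swapped,
  -- i.e. v(k) = w(t_{i,j}(k)).
  swapPositions : Permutation′ n → Fin n → Fin n → Permutation′ n
  swapPositions w i j = transpose i j ∘ₚ w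

-- Polynomial ring κ[z_{i,j} : i,j ∈ [n]].
-- A polynomial is a finite formal sum of terms (coefficient, monomial);
-- two polynomials are equal when all their coefficients agree.

module Poly {c ℓ : Level} (κ : Field c ℓ) (n : ℕ) where
  open Field κ

  Monomial : Set
  Monomial = Fin n → Fin n → ℕ

  _≟ₘ_ : (m m' : Monomial) → Dec (∀ i j → m i j ≡ m' i j)
  m ≟ₘ m' = all? (λ i → all? (λ j → m i j ℕ.≟ m' i j))

  Polynomial : Set c
  Polynomial = List (Carrier × Monomial)

  coeff : Polynomial → Monomial → Carrier
  coeff [] m = 0#
  coeff ((a , m') ∷ p) m with m' ≟ₘ m
  ... | yes _ = a + coeff p m
  ... | no  _ = coeff p m

  infix 4 _≈ₚ_
  _≈ₚ_ : Polynomial → Polynomial → Set ℓ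
  p ≈ₚ q = ∀ m → coeff p m ≈ coeff q m

  0ₚ : Polynomial
  0ₚ = []

  oneMon : Monomial
  oneMon _ _ = 0

  1ₚ : Polynomial
  1ₚ = (1# , oneMon) ∷ []

  infixl 6 _+ₚ_
  infixl 7 _*ₚ_
  _+ₚ_ : Polynomial → Polynomial → Polynomial
  _+ₚ_ = _++_

  -ₚ_ : Polynomial → Polynomial
  -ₚ_ = map (λ t → (- proj₁ t , proj₂ t))

  _*ₚ_ : Polynomial → Polynomial → Polynomial
  p *ₚ q = concatMap (λ s → map (λ t → (proj₁ s * proj₁ t , λ i j → proj₂ s i j ℕ.+ proj₂ t i j)) q) p

  var : Fin n → Fin n → Polynomial
  var i j = (1# , (λ k l → b2n (⌊ k Fin.≟ i ⌋ ∧ ⌊ l Fin.≟ j ⌋))) ∷ []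
    where
      open import Data.Bool using (Bool; true; false; _∧_)
      open import Relation.Nullary.Decidable using (⌊_⌋)
      b2n : Bool → ℕ
      b2n true = 1
      b2n false = 0

  sumₚ : List Polynomial → Polynomial
  sumₚ = foldr _+ₚ_ 0ₚ

  det : (k : ℕ) → (Fin k → Fin k → Polynomial) → Polynomial
  det zero M = 1ₚ
  det (suc k) M = sumₚ (map (λ j → sign j (M Fin.zero j *ₚ det k (λ r s → M (Fin.suc r) (punchIn j s))))
                            (Data.List.Base.allFin (suc k)))
    where
      import Data.List.Base
      sgn : ℕ → Polynomial → Polynomial
      sgn zero p = p
      sgn (suc zero) p = -ₚ p
      sgn (suc (suc m)) p = sgn m p
      sign : Fin (suc k) → Polynomial → Polynomial
      sign j = sgn (toℕ j)

  StrictlyIncreasing : {k : ℕ} → (Fin k → Fin n) → Set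
  StrictlyIncreasing R = ∀ r s → toℕ r < toℕ s → toℕ (R r) < toℕ (R s)

  minor : (k : ℕ) → (Fin k → Fin n) → (Fin k → Fin n) → Polynomial
  minor k R C = det k (λ r s → var (R r) (C s))

  IsNWMinor : ℕ → Fin n → Fin n → Polynomial → Set c
  IsNWMinor k i j p = Σ (Fin k → Fin n) λ R → Σ (Fin k → Fin n) λ C →
      StrictlyIncreasing R × StrictlyIncreasing C
    × (∀ r → toℕ (R r) ≤ toℕ i) × (∀ s → toℕ (C s) ≤ toℕ j)
    × p ≡ minor k R C

  SchubertGen : Permutation′ n → Pred Polynomial _
  SchubertGen w p = ∃[ i ] ∃[ j ] IsNWMinor (suc (rk w i j)) i j p

  FultonGen : Permutation′ n → Pred Polynomial _
  FultonGen w p = ∃[ i ] ∃[ j ] (InEss w i j × IsNWMinor (suc (rk w i j)) i j p)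

  _∈⟨_⟩ : ∀ {ℓ'} → Polynomial → Pred Polynomial ℓ' → Set (c ⊔ ℓ ⊔ ℓ')
  p ∈⟨ G ⟩ = Σ (List (Polynomial × Σ Polynomial G)) λ cs →
    p ≈ₚ sumₚ (map (λ t → proj₁ t *ₚ proj₁ (proj₂ t)) cs)

  _≐ᵢ_ : ∀ {ℓ₁ ℓ₂} → Pred Polynomial ℓ₁ → Pred Polynomial ℓ₂ → Set (c ⊔ ℓ ⊔ ℓ₁ ⊔ ℓ₂)
  G ≐ᵢ H = ∀ p → ((p ∈⟨ G ⟩ → p ∈⟨ H ⟩) × (p ∈⟨ H ⟩ → p ∈⟨ G ⟩))

  NoTermDivisibleBy : Fin n → Fin n → Polynomial → Set ℓ
  NoTermDivisibleBy a b p = ∀ m → 1 ≤ m a b → coeff p m ≈ 0#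

module Submission where

-- Removing z_{a,b} leaves the Fulton generators of I_w that live north or west of the
-- corner (a,b): at (a,b) itself a minor contains z_{a,b} (with coefficient ±1) unless it
-- avoids row a or column b, and then it is a minor one row up or one column left. North
-- or west of (a,b) the rank functions of w and v agree, and D(v) ⊆ D(w) lies there, so
-- every Fulton generator of v is such an h and every h is a generator of I_v. Finally I_v
-- is generated by its Fulton generators: off D(v) a rank condition follows from the one a
-- row up or a column left by Laplace expansion, and inside D(v) it equals the condition at
-- an essential box further southeast.

open import Defs
open import Level using (Level; _⊔_)
open import Data.Nat as ℕ using (ℕ; zero; suc; _∸_)
import Data.Nat.Properties as ℕP
open import Data.Fin as Fin using (Fin; toℕ; punchIn; inject₁; fromℕ)
import Data.Fin.Properties as FinP
open import Data.Fin.Permutation using (Permutation′; _⟨$⟩ˡ_; _⟨$⟩ʳ_; inverseˡ; inverseʳ)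
open import Data.List as L using (List; []; _∷_; _++_)
open import Data.Product using (Σ; ∃-syntax; _×_; _,_; proj₁; proj₂)
open import Data.Sum using (_⊎_; inj₁; inj₂)
open import Data.Maybe using (nothing)
open import Data.Empty using (⊥; ⊥-elim)
open import Relation.Nullary using (¬_; Dec; yes; no)
open import Relation.Unary using (Pred)
open import Relation.Binary.PropositionalEquality as P using (_≡_; _≢_)
open import Algebra.Bundles using (CommutativeRing)
open import Algebra.Structures using (IsCommutativeRing)
import Algebra.Solver.Ring.AlmostCommutativeRing as ACR

module RingSolver {r₁ r₂ : Level} (R : CommutativeRing r₁ r₂) where
  private
    R′ = ACR.fromCommutativeRing R
  open import Algebra.Solver.Ring (ACR.AlmostCommutativeRing.rawRing R′) R′
    (ACR.-raw-almostCommutative⟶ R′) (λ _ _ → nothing) public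

module PolynomialRing {c ℓ : Level} (κ : Field c ℓ) (n : ℕ) where
  open Poly κ n
  open Field κ
  open import Relation.Binary.Reasoning.Setoid setoid
  open RingSolver commutativeRing using (solve; _:=_; _:+_; _:*_; :-_)
  open import Algebra.Properties.Ring ring using (-‿distribˡ-*)

  Functional : Set c
  Functional = Monomial → Carrier

  _+ₘ_ : Monomial → Monomial → Monomial
  (m₁ +ₘ m₂) i j = m₁ i j ℕ.+ m₂ i j

  _≗ₘ_ : Monomial → Monomial → Set
  m ≗ₘ m' = ∀ i j → m i j ≡ m' i j

  Respects≗ₘ : Functional → Set ℓ
  Respects≗ₘ G = ∀ {m m'} → m ≗ₘ m' → G m ≈ G m'

  ⟦_⟧ : Polynomial → Functional → Carrier
  ⟦ [] ⟧ G = 0#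
  ⟦ (a , m) ∷ p ⟧ G = a * G m + ⟦ p ⟧ G

  -- Polynomials are identified when every well-defined functional on monomials
  -- takes the same value on them; all ring laws then reduce to laws of κ.
  infix 4 _∼_
  record _∼_ (p q : Polynomial) : Set (c ⊔ ℓ) where
    constructor mk∼
    field run : ∀ G → Respects≗ₘ G → ⟦ p ⟧ G ≈ ⟦ q ⟧ G
  open _∼_ public

  ⟦⟧-cong : ∀ p {G G' : Functional} → (∀ m → G m ≈ G' m) → ⟦ p ⟧ G ≈ ⟦ p ⟧ G'
  ⟦⟧-cong [] e = refl
  ⟦⟧-cong ((a , m) ∷ p) e = +-cong (*-cong refl (e m)) (⟦⟧-cong p e)

  ⟦++⟧ : ∀ p q G → ⟦ p ++ q ⟧ G ≈ ⟦ p ⟧ G + ⟦ q ⟧ G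
  ⟦++⟧ [] q G = sym (+-identityˡ _)
  ⟦++⟧ ((a , m) ∷ p) q G = trans (+-cong refl (⟦++⟧ p q G)) (sym (+-assoc _ _ _))

  ⟦-ₚ⟧ : ∀ p G → ⟦ -ₚ p ⟧ G ≈ - ⟦ p ⟧ G
  ⟦-ₚ⟧ [] G = trans (sym (-‿inverseˡ 0#)) (+-identityʳ (- 0#))
  ⟦-ₚ⟧ ((a , m) ∷ p) G = begin
    - a * G m + ⟦ -ₚ p ⟧ G   ≈⟨ +-cong (sym (-‿distribˡ-* a (G m))) (⟦-ₚ⟧ p G) ⟩
    - (a * G m) + - ⟦ p ⟧ G  ≈⟨ solve 2 (λ x y → (:- x) :+ (:- y) := :- (x :+ y)) refl _ _ ⟩
    - (a * G m + ⟦ p ⟧ G)    ∎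

  ⟦⟧-+ : ∀ p (G G' : Functional) → ⟦ p ⟧ (λ m → G m + G' m) ≈ ⟦ p ⟧ G + ⟦ p ⟧ G'
  ⟦⟧-+ [] G G' = sym (+-identityˡ _)
  ⟦⟧-+ ((a , m) ∷ p) G G' = trans (+-cong (distribˡ a (G m) (G' m)) (⟦⟧-+ p G G'))
    (solve 4 (λ x y z w → (x :+ y) :+ (z :+ w) := (x :+ z) :+ (y :+ w)) refl _ _ _ _)

  ⟦⟧-* : ∀ p (a : Carrier) (G : Functional) → ⟦ p ⟧ (λ m → a * G m) ≈ a * ⟦ p ⟧ G
  ⟦⟧-* [] a G = sym (zeroʳ a)
  ⟦⟧-* ((b , m) ∷ p) a G = trans (+-cong refl (⟦⟧-* p a G))
    (solve 4 (λ a b g r → b :* (a :* g) :+ a :* r := a :* (b :* g :+ r)) refl a b (G m) (⟦ p ⟧ G))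

  ⟦⟧-0 : ∀ p → ⟦ p ⟧ (λ _ → 0#) ≈ 0#
  ⟦⟧-0 [] = refl
  ⟦⟧-0 ((b , m) ∷ p) = trans (+-cong (zeroʳ b) (⟦⟧-0 p)) (+-identityʳ 0#)

  ⟦⟧-comm : ∀ p q (H : Monomial → Monomial → Carrier) →
            ⟦ p ⟧ (λ x → ⟦ q ⟧ (H x)) ≈ ⟦ q ⟧ (λ y → ⟦ p ⟧ (λ x → H x y))
  ⟦⟧-comm [] q H = sym (⟦⟧-0 q)
  ⟦⟧-comm ((a , m) ∷ p) q H = begin
    a * ⟦ q ⟧ (H m) + ⟦ p ⟧ (λ x → ⟦ q ⟧ (H x))
      ≈⟨ +-cong (sym (⟦⟧-* q a (H m))) (⟦⟧-comm p q H) ⟩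
    ⟦ q ⟧ (λ y → a * H m y) + ⟦ q ⟧ (λ y → ⟦ p ⟧ (λ x → H x y))
      ≈⟨ sym (⟦⟧-+ q _ _) ⟩
    ⟦ q ⟧ (λ y → a * H m y + ⟦ p ⟧ (λ x → H x y)) ∎

  termTimes : Carrier → Monomial → Polynomial → Polynomial
  termTimes a m₁ = L.map (λ t → (a * proj₁ t , λ i j → m₁ i j ℕ.+ proj₂ t i j))

  ⟦termTimes⟧ : ∀ a m₁ q G → ⟦ termTimes a m₁ q ⟧ G ≈ a * ⟦ q ⟧ (λ m₂ → G (m₁ +ₘ m₂))
  ⟦termTimes⟧ a m₁ [] G = sym (zeroʳ a)
  ⟦termTimes⟧ a m₁ ((b , m) ∷ q) G = trans (+-cong refl (⟦termTimes⟧ a m₁ q G))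
    (trans (+-cong (*-assoc a b _) refl) (sym (distribˡ a _ _)))

  ⟦*ₚ⟧ : ∀ p q G → ⟦ p *ₚ q ⟧ G ≈ ⟦ p ⟧ (λ m₁ → ⟦ q ⟧ (λ m₂ → G (m₁ +ₘ m₂)))
  ⟦*ₚ⟧ [] q G = refl
  ⟦*ₚ⟧ ((a , m) ∷ p) q G =
    trans (⟦++⟧ (termTimes a m q) (p *ₚ q) G) (+-cong (⟦termTimes⟧ a m q G) (⟦*ₚ⟧ p q G))

  respects-shift : ∀ {G} → Respects≗ₘ G → ∀ m₁ → Respects≗ₘ (λ m₂ → G (m₁ +ₘ m₂))
  respects-shift RG m₁ e = RG (λ i j → P.cong (m₁ i j ℕ.+_) (e i j))

  respects-⟦⟧-shift : ∀ {G} → Respects≗ₘ G → ∀ q → Respects≗ₘ (λ m₁ → ⟦ q ⟧ (λ m₂ → G (m₁ +ₘ m₂)))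
  respects-⟦⟧-shift RG q e = ⟦⟧-cong q (λ m₂ → RG (λ i j → P.cong (ℕ._+ m₂ i j) (e i j)))

  ∼-refl : ∀ {p} → p ∼ p
  ∼-refl = mk∼ λ G RG → refl

  ∼-sym : ∀ {p q} → p ∼ q → q ∼ p
  ∼-sym e = mk∼ λ G RG → sym (run e G RG)

  ∼-trans : ∀ {p q r} → p ∼ q → q ∼ r → p ∼ r
  ∼-trans e f = mk∼ λ G RG → trans (run e G RG) (run f G RG)

  +ₚ-cong : ∀ {p p' q q'} → p ∼ p' → q ∼ q' → (p +ₚ q) ∼ (p' +ₚ q')
  +ₚ-cong {p} {p'} {q} {q'} e f = mk∼ λ G RG →
    trans (⟦++⟧ p q G) (trans (+-cong (run e G RG) (run f G RG)) (sym (⟦++⟧ p' q' G)))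

  -ₚ-cong : ∀ {p p'} → p ∼ p' → (-ₚ p) ∼ (-ₚ p')
  -ₚ-cong {p} {p'} e = mk∼ λ G RG →
    trans (⟦-ₚ⟧ p G) (trans (-‿cong (run e G RG)) (sym (⟦-ₚ⟧ p' G)))

  *ₚ-cong : ∀ {p p' q q'} → p ∼ p' → q ∼ q' → (p *ₚ q) ∼ (p' *ₚ q')
  *ₚ-cong {p} {p'} {q} {q'} e f = mk∼ λ G RG → begin
    ⟦ p *ₚ q ⟧ G                                   ≈⟨ ⟦*ₚ⟧ p q G ⟩
    ⟦ p ⟧ (λ m₁ → ⟦ q ⟧ (λ m₂ → G (m₁ +ₘ m₂)))   ≈⟨ run e _ (respects-⟦⟧-shift RG q) ⟩
    ⟦ p' ⟧ (λ m₁ → ⟦ q ⟧ (λ m₂ → G (m₁ +ₘ m₂)))  ≈⟨ ⟦⟧-cong p' (λ m₁ → run f _ (respects-shift RG m₁)) ⟩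
    ⟦ p' ⟧ (λ m₁ → ⟦ q' ⟧ (λ m₂ → G (m₁ +ₘ m₂))) ≈⟨ sym (⟦*ₚ⟧ p' q' G) ⟩
    ⟦ p' *ₚ q' ⟧ G                                 ∎

  +ₚ-assoc : ∀ p q r → ((p +ₚ q) +ₚ r) ∼ (p +ₚ (q +ₚ r))
  +ₚ-assoc p q r = mk∼ λ G RG → begin
    ⟦ (p ++ q) ++ r ⟧ G            ≈⟨ ⟦++⟧ (p ++ q) r G ⟩
    ⟦ p ++ q ⟧ G + ⟦ r ⟧ G         ≈⟨ +-cong (⟦++⟧ p q G) refl ⟩
    (⟦ p ⟧ G + ⟦ q ⟧ G) + ⟦ r ⟧ G  ≈⟨ +-assoc _ _ _ ⟩
    ⟦ p ⟧ G + (⟦ q ⟧ G + ⟦ r ⟧ G)  ≈⟨ +-cong refl (sym (⟦++⟧ q r G)) ⟩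
    ⟦ p ⟧ G + ⟦ q ++ r ⟧ G         ≈⟨ sym (⟦++⟧ p (q ++ r) G) ⟩
    ⟦ p ++ (q ++ r) ⟧ G            ∎

  +ₚ-comm : ∀ p q → (p +ₚ q) ∼ (q +ₚ p)
  +ₚ-comm p q = mk∼ λ G RG → trans (⟦++⟧ p q G) (trans (+-comm _ _) (sym (⟦++⟧ q p G)))

  +ₚ-identityˡ : ∀ p → (0ₚ +ₚ p) ∼ p
  +ₚ-identityˡ p = ∼-refl

  +ₚ-identityʳ : ∀ p → (p +ₚ 0ₚ) ∼ p
  +ₚ-identityʳ p = mk∼ λ G RG → trans (⟦++⟧ p [] G) (+-identityʳ _)

  -ₚ-inverseˡ : ∀ p → ((-ₚ p) +ₚ p) ∼ 0ₚ
  -ₚ-inverseˡ p = mk∼ λ G RG →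
    trans (⟦++⟧ (-ₚ p) p G) (trans (+-cong (⟦-ₚ⟧ p G) refl) (-‿inverseˡ _))

  -ₚ-inverseʳ : ∀ p → (p +ₚ (-ₚ p)) ∼ 0ₚ
  -ₚ-inverseʳ p = mk∼ λ G RG →
    trans (⟦++⟧ p (-ₚ p) G) (trans (+-cong refl (⟦-ₚ⟧ p G)) (-‿inverseʳ _))

  *ₚ-comm : ∀ p q → (p *ₚ q) ∼ (q *ₚ p)
  *ₚ-comm p q = mk∼ λ G RG → begin
    ⟦ p *ₚ q ⟧ G                             ≈⟨ ⟦*ₚ⟧ p q G ⟩
    ⟦ p ⟧ (λ a → ⟦ q ⟧ (λ b → G (a +ₘ b)))  ≈⟨ ⟦⟧-comm p q (λ a b → G (a +ₘ b)) ⟩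
    ⟦ q ⟧ (λ b → ⟦ p ⟧ (λ a → G (a +ₘ b)))
      ≈⟨ ⟦⟧-cong q (λ b → ⟦⟧-cong p (λ a → RG (λ i j → ℕP.+-comm (a i j) (b i j)))) ⟩
    ⟦ q ⟧ (λ b → ⟦ p ⟧ (λ a → G (b +ₘ a)))  ≈⟨ sym (⟦*ₚ⟧ q p G) ⟩
    ⟦ q *ₚ p ⟧ G                             ∎

  *ₚ-assoc : ∀ p q r → ((p *ₚ q) *ₚ r) ∼ (p *ₚ (q *ₚ r))
  *ₚ-assoc p q r = mk∼ λ G RG → let F = λ u → ⟦ r ⟧ (λ x → G (u +ₘ x)) in begin
    ⟦ (p *ₚ q) *ₚ r ⟧ G                      ≈⟨ ⟦*ₚ⟧ (p *ₚ q) r G ⟩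
    ⟦ p *ₚ q ⟧ F                             ≈⟨ ⟦*ₚ⟧ p q F ⟩
    ⟦ p ⟧ (λ a → ⟦ q ⟧ (λ b → F (a +ₘ b)))
      ≈⟨ ⟦⟧-cong p (λ a → ⟦⟧-cong q (λ b → ⟦⟧-cong r (λ x →
           RG (λ i j → ℕP.+-assoc (a i j) (b i j) (x i j))))) ⟩
    ⟦ p ⟧ (λ a → ⟦ q ⟧ (λ b → ⟦ r ⟧ (λ x → G (a +ₘ (b +ₘ x)))))
      ≈⟨ ⟦⟧-cong p (λ a → sym (⟦*ₚ⟧ q r (λ v → G (a +ₘ v)))) ⟩
    ⟦ p ⟧ (λ a → ⟦ q *ₚ r ⟧ (λ v → G (a +ₘ v))) ≈⟨ sym (⟦*ₚ⟧ p (q *ₚ r) G) ⟩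
    ⟦ p *ₚ (q *ₚ r) ⟧ G                      ∎

  *ₚ-identityˡ : ∀ p → (1ₚ *ₚ p) ∼ p
  *ₚ-identityˡ p = mk∼ λ G RG → trans (⟦*ₚ⟧ 1ₚ p G) (trans (+-identityʳ _) (*-identityˡ _))

  *ₚ-identityʳ : ∀ p → (p *ₚ 1ₚ) ∼ p
  *ₚ-identityʳ p = ∼-trans (*ₚ-comm p 1ₚ) (*ₚ-identityˡ p)

  *ₚ-distribˡ : ∀ p q r → (p *ₚ (q +ₚ r)) ∼ ((p *ₚ q) +ₚ (p *ₚ r))
  *ₚ-distribˡ p q r = mk∼ λ G RG → begin
    ⟦ p *ₚ (q ++ r) ⟧ G                          ≈⟨ ⟦*ₚ⟧ p (q ++ r) G ⟩
    ⟦ p ⟧ (λ a → ⟦ q ++ r ⟧ (λ b → G (a +ₘ b)))  ≈⟨ ⟦⟧-cong p (λ a → ⟦++⟧ q r _) ⟩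
    ⟦ p ⟧ (λ a → ⟦ q ⟧ (λ b → G (a +ₘ b)) + ⟦ r ⟧ (λ b → G (a +ₘ b))) ≈⟨ ⟦⟧-+ p _ _ ⟩
    ⟦ p ⟧ (λ a → ⟦ q ⟧ (λ b → G (a +ₘ b))) + ⟦ p ⟧ (λ a → ⟦ r ⟧ (λ b → G (a +ₘ b)))
      ≈⟨ +-cong (sym (⟦*ₚ⟧ p q G)) (sym (⟦*ₚ⟧ p r G)) ⟩
    ⟦ p *ₚ q ⟧ G + ⟦ p *ₚ r ⟧ G                  ≈⟨ sym (⟦++⟧ (p *ₚ q) (p *ₚ r) G) ⟩
    ⟦ (p *ₚ q) ++ (p *ₚ r) ⟧ G                   ∎

  *ₚ-distribʳ : ∀ p q r → ((q +ₚ r) *ₚ p) ∼ ((q *ₚ p) +ₚ (r *ₚ p))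
  *ₚ-distribʳ p q r = mk∼ λ G RG → let F = λ a → ⟦ p ⟧ (λ b → G (a +ₘ b)) in begin
    ⟦ (q ++ r) *ₚ p ⟧ G          ≈⟨ ⟦*ₚ⟧ (q ++ r) p G ⟩
    ⟦ q ++ r ⟧ F                 ≈⟨ ⟦++⟧ q r F ⟩
    ⟦ q ⟧ F + ⟦ r ⟧ F            ≈⟨ +-cong (sym (⟦*ₚ⟧ q p G)) (sym (⟦*ₚ⟧ r p G)) ⟩
    ⟦ q *ₚ p ⟧ G + ⟦ r *ₚ p ⟧ G  ≈⟨ sym (⟦++⟧ (q *ₚ p) (r *ₚ p) G) ⟩
    ⟦ (q *ₚ p) ++ (r *ₚ p) ⟧ G   ∎

  -- Sealed so that type checking never unfolds ring expressions into list operations.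
  opaque
    infixl 6 _⊕_
    infixl 7 _⊗_
    _⊕_ : Polynomial → Polynomial → Polynomial
    _⊕_ = _+ₚ_
    _⊗_ : Polynomial → Polynomial → Polynomial
    _⊗_ = _*ₚ_
    ⊖_ : Polynomial → Polynomial
    ⊖_ = -ₚ_

  opaque
    unfolding _⊕_ _⊗_ ⊖_
    ⊕≡+ₚ : ∀ p q → p ⊕ q ≡ p +ₚ q
    ⊕≡+ₚ p q = P.refl
    ⊗≡*ₚ : ∀ p q → p ⊗ q ≡ p *ₚ q
    ⊗≡*ₚ p q = P.refl
    ⊖≡-ₚ : ∀ p → ⊖ p ≡ -ₚ p
    ⊖≡-ₚ p = P.refl

    ∼-isCommutativeRing : IsCommutativeRing _∼_ _⊕_ _⊗_ ⊖_ 0ₚ 1ₚ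
    ∼-isCommutativeRing = record
      { isRing = record
        { +-isAbelianGroup = record
          { isGroup = record
            { isMonoid = record
              { isSemigroup = record
                { isMagma = record
                  { isEquivalence = record { refl = ∼-refl ; sym = ∼-sym ; trans = ∼-trans }
                  ; ∙-cong = +ₚ-cong }
                ; assoc = +ₚ-assoc }
              ; identity = +ₚ-identityˡ , +ₚ-identityʳ }
            ; inverse = -ₚ-inverseˡ , -ₚ-inverseʳ
            ; ⁻¹-cong = -ₚ-cong }
          ; comm = +ₚ-comm }
        ; *-cong = *ₚ-cong
        ; *-assoc = *ₚ-assoc
        ; *-identity = *ₚ-identityˡ , *ₚ-identityʳ
        ; distrib = *ₚ-distribˡ , *ₚ-distribʳ }
      ; *-comm = *ₚ-comm }

  polynomialRing : CommutativeRing c (c ⊔ ℓ)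
  polynomialRing = record { isCommutativeRing = ∼-isCommutativeRing }

  indicator : Monomial → Functional
  indicator m m' with m' ≟ₘ m
  ... | yes _ = 1#
  ... | no _ = 0#

  indicator-respects : ∀ m → Respects≗ₘ (indicator m)
  indicator-respects m {m₁} {m₂} e with m₁ ≟ₘ m | m₂ ≟ₘ m
  ... | yes _  | yes _  = refl
  ... | no _   | no _   = refl
  ... | yes e₁ | no ne  = ⊥-elim (ne (λ i j → P.trans (P.sym (e i j)) (e₁ i j)))
  ... | no ne  | yes e₂ = ⊥-elim (ne (λ i j → P.trans (e i j) (e₂ i j)))

  coeff≈⟦⟧indicator : ∀ p m → coeff p m ≈ ⟦ p ⟧ (indicator m)
  coeff≈⟦⟧indicator [] m = refl
  coeff≈⟦⟧indicator ((a , m') ∷ p) m with m' ≟ₘ m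
  ... | yes _ = +-cong (sym (*-identityʳ a)) (coeff≈⟦⟧indicator p m)
  ... | no _ = trans (coeff≈⟦⟧indicator p m)
                     (trans (sym (+-identityˡ _)) (+-cong (sym (zeroʳ a)) refl))

  ∼⇒≈ₚ : ∀ {p q} → p ∼ q → p ≈ₚ q
  ∼⇒≈ₚ {p} {q} e m = trans (coeff≈⟦⟧indicator p m)
    (trans (run e (indicator m) (indicator-respects m)) (sym (coeff≈⟦⟧indicator q m)))

module Determinant {c ℓ : Level} (κ : Field c ℓ) (n : ℕ) where
  open Poly κ n
  open PolynomialRing κ n using (polynomialRing; _⊕_; _⊗_; ⊖_)
  open CommutativeRing polynomialRing
  open import Relation.Binary.Reasoning.Setoid setoid
  open import Algebra.Properties.CommutativeMonoid.Sum +-commutativeMonoid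
    using (sum; ∑-comm; sum-cong-≋; sum-init-last)
  open import Algebra.Properties.Semiring.Sum semiring using (*-distribˡ-sum)
  open import Algebra.Properties.Ring ring using (-‿distribˡ-*; -‿involutive; -1*x≈-x)
  import Algebra.Solver.CommutativeMonoid *-commutativeMonoid as ×-Solver

  Matrix : ℕ → Set c
  Matrix k = Fin k → Fin k → Polynomial

  opaque
    ∑ : ∀ {k} → (Fin k → Polynomial) → Polynomial
    ∑ = sum

  opaque
    unfolding ∑
    ∑-cong : ∀ {k} (f g : Fin k → Polynomial) → (∀ i → f i ≈ g i) → ∑ f ≈ ∑ g
    ∑-cong f g eq = sum-cong-≋ eq

    ∑-head : ∀ {k} (f : Fin (suc k) → Polynomial) → ∑ f ≈ f Fin.zero + ∑ (λ i → f (Fin.suc i))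
    ∑-head f = refl

    ∑-last : ∀ {k} (f : Fin (suc k) → Polynomial) → ∑ f ≈ ∑ (λ i → f (inject₁ i)) + f (fromℕ k)
    ∑-last f = sum-init-last f

    ∑-swap : ∀ {k m} (f : Fin k → Fin m → Polynomial) →
             ∑ (λ i → ∑ (λ j → f i j)) ≈ ∑ (λ j → ∑ (λ i → f i j))
    ∑-swap f = ∑-comm f

    ∑-distribˡ : ∀ {k} x (f : Fin k → Polynomial) → x * ∑ f ≈ ∑ (λ i → x * f i)
    ∑-distribˡ x f = *-distribˡ-sum x f

    ∑-empty : ∀ {f : Fin 0 → Polynomial} → ∑ f ≈ 0#
    ∑-empty = refl

  -- `det` multiplies each Laplace term by a sign function local to its where-block; it is
  -- recovered by unification, and as it does not depend on the matrix one instance serves.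
  private
    laplaceTerms : ∀ k (M : Matrix (suc k)) → Σ (Fin (suc k) → Polynomial) λ F →
                   det (suc k) M ≡ L.foldr _+ₚ_ 0ₚ (L.map F (L.allFin (suc k)))
    laplaceTerms k M = _ , P.refl

    signingOf : ∀ k (M : Matrix (suc k)) (j : Fin (suc k)) → Σ (ℕ → Polynomial → Polynomial) λ S →
                proj₁ (laplaceTerms k M) j ≡ S (toℕ j) (M Fin.zero j *ₚ det k (λ r s → M (Fin.suc r) (punchIn j s)))
    signingOf k M j = S , eq
      where S : ℕ → Polynomial → Polynomial
            S = _
            eq : proj₁ (laplaceTerms k M) j ≡ S (toℕ j) (M Fin.zero j *ₚ det k (λ r s → M (Fin.suc r) (punchIn j s)))
            eq with toℕ j | M Fin.zero j *ₚ det k (λ r s → M (Fin.suc r) (punchIn j s))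
            ... | _ | _ = P.refl

  signing : ℕ → Polynomial → Polynomial
  signing = proj₁ (signingOf 0 (λ _ _ → 0ₚ) Fin.zero)

  opaque
    unfolding _⊕_ _⊗_ ⊖_
    foldr-map-tabulate : ∀ {A : Set} k (g : Fin k → A) (f : A → Polynomial) →
                         L.foldr _+ₚ_ 0ₚ (L.map f (L.tabulate g)) ≡ sum (λ i → f (g i))
    foldr-map-tabulate zero g f = P.refl
    foldr-map-tabulate (suc k) g f = P.cong (f (g Fin.zero) +_) (foldr-map-tabulate k (λ i → g (Fin.suc i)) f)

    det≡sum : ∀ k (M : Matrix (suc k)) →
              det (suc k) M ≡ sum (λ j → signing (toℕ j) (M Fin.zero j * det k (λ r s → M (Fin.suc r) (punchIn j s))))
    det≡sum k M = foldr-map-tabulate (suc k) (λ j → j) _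

    signing≈* : ∀ m x → signing m x ≈ signing m 1# * x
    signing≈* zero x = sym (*-identityˡ x)
    signing≈* (suc zero) x = sym (-1*x≈-x x)
    signing≈* (suc (suc m)) x = signing≈* m x

    signing-suc : ∀ m → signing (suc m) 1# ≈ - signing m 1#
    signing-suc zero = refl
    signing-suc (suc zero) = sym (-‿involutive 1#)
    signing-suc (suc (suc m)) = signing-suc m

  opaque
    sign : ℕ → Polynomial
    sign m = signing m 1#

  opaque
    unfolding sign
    signing≈sign* : ∀ m x → signing m x ≈ sign m * x
    signing≈sign* = signing≈*

    sign-zero : sign 0 ≈ 1#
    sign-zero = refl

    sign-suc : ∀ m → sign (suc m) ≈ - sign m
    sign-suc = signing-suc

    sign-suc-suc : ∀ m → sign (suc (suc m)) ≈ sign m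
    sign-suc-suc m = refl

  opaque
    unfolding ∑
    det-expandFirstRow : ∀ k (M : Matrix (suc k)) →
      det (suc k) M ≈ ∑ (λ j → sign (toℕ j) * (M Fin.zero j * det k (λ r s → M (Fin.suc r) (punchIn j s))))
    det-expandFirstRow k M =
      trans (reflexive (det≡sum k M))
        (sum-cong-≋ (λ j → signing≈sign* (toℕ j) (M Fin.zero j * det k (λ r s → M (Fin.suc r) (punchIn j s)))))

  det-cong : ∀ k {M N : Matrix k} → (∀ r s → M r s ≈ N r s) → det k M ≈ det k N
  det-cong zero eq = refl
  det-cong (suc k) {M} {N} eq = begin
    det (suc k) M
      ≈⟨ det-expandFirstRow k M ⟩
    ∑ (λ j → sign (toℕ j) * (M Fin.zero j * det k (λ r s → M (Fin.suc r) (punchIn j s))))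
      ≈⟨ ∑-cong _ _ (λ j → *-cong refl (*-cong (eq Fin.zero j) (det-cong k (λ r s → eq (Fin.suc r) (punchIn j s))))) ⟩
    ∑ (λ j → sign (toℕ j) * (N Fin.zero j * det k (λ r s → N (Fin.suc r) (punchIn j s))))
      ≈⟨ sym (det-expandFirstRow k N) ⟩
    det (suc k) N ∎

  ∑∑-exchange : ∀ {k m} (α δ : Fin k → Polynomial) (β γ : Fin m → Polynomial)
                (A : Fin k → Polynomial) (B : Fin m → Polynomial) (X : Fin m → Fin k → Polynomial) →
                (∀ u r → α u * β r ≈ γ r * δ u) →
                ∑ (λ u → α u * (A u * ∑ (λ r → β r * (B r * X r u)))) ≈
                ∑ (λ r → γ r * (B r * ∑ (λ u → δ u * (A u * X r u))))
  ∑∑-exchange α δ β γ A B X signs = begin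
    ∑ (λ u → α u * (A u * ∑ (λ r → β r * (B r * X r u))))
      ≈⟨ ∑-cong _ _ (λ u → trans (*-cong refl (∑-distribˡ (A u) _)) (∑-distribˡ (α u) _)) ⟩
    ∑ (λ u → ∑ (λ r → α u * (A u * (β r * (B r * X r u)))))
      ≈⟨ ∑-swap _ ⟩
    ∑ (λ r → ∑ (λ u → α u * (A u * (β r * (B r * X r u)))))
      ≈⟨ ∑-cong _ _ (λ r → ∑-cong _ _ (λ u → reorder (α u) (A u) (β r) (B r) (X r u) (γ r) (δ u) (signs u r))) ⟩
    ∑ (λ r → ∑ (λ u → γ r * (B r * (δ u * (A u * X r u)))))
      ≈⟨ sym (∑-cong _ _ (λ r → trans (*-cong refl (∑-distribˡ (B r) _)) (∑-distribˡ (γ r) _))) ⟩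
    ∑ (λ r → γ r * (B r * ∑ (λ u → δ u * (A u * X r u)))) ∎
    where
      open ×-Solver using (solve; _⊜_) renaming (_⊕_ to _·_)
      reorder : ∀ α A β B X γ δ → α * β ≈ γ * δ → α * (A * (β * (B * X))) ≈ γ * (B * (δ * (A * X)))
      reorder α A β B X γ δ αβ≈γδ = begin
        α * (A * (β * (B * X)))  ≈⟨ solve 5 (λ α A β B X → α · (A · (β · (B · X))) ⊜ (α · β) · (A · (B · X))) refl α A β B X ⟩
        (α * β) * (A * (B * X))  ≈⟨ *-cong αβ≈γδ refl ⟩
        (γ * δ) * (A * (B * X))  ≈⟨ solve 5 (λ γ B δ A X → (γ · δ) · (A · (B · X)) ⊜ γ · (B · (δ · (A · X)))) refl γ B δ A X ⟩
        γ * (B * (δ * (A * X)))  ∎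

  det-expandFirstColumn : ∀ k (M : Matrix (suc k)) →
    det (suc k) M ≈ ∑ (λ r → sign (toℕ r) * (M r Fin.zero * det k (λ a b → M (punchIn r a) (Fin.suc b))))
  det-expandFirstColumn zero M = trans (det-expandFirstRow 0 M) (∑-cong _ _ (λ { Fin.zero → refl }))
  det-expandFirstColumn (suc k) M = begin
    det (suc (suc k)) M
      ≈⟨ det-expandFirstRow (suc k) M ⟩
    ∑ (λ j → sign (toℕ j) * (M Fin.zero j * det (suc k) (λ r s → M (Fin.suc r) (punchIn j s))))
      ≈⟨ ∑-head _ ⟩
    T₀ + ∑ (λ u → sign (suc (toℕ u)) * (M Fin.zero (Fin.suc u) * det (suc k) (λ r s → M (Fin.suc r) (punchIn (Fin.suc u) s))))
      ≈⟨ +-cong refl (∑-cong _ _ (λ u → *-cong refl (*-cong refl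
           (det-expandFirstColumn k (λ r s → M (Fin.suc r) (punchIn (Fin.suc u) s)))))) ⟩
    T₀ + ∑ (λ u → sign (suc (toℕ u)) * (M Fin.zero (Fin.suc u) * ∑ (λ r → sign (toℕ r) * (M (Fin.suc r) Fin.zero * X r u))))
      ≈⟨ +-cong refl (∑∑-exchange (λ u → sign (suc (toℕ u))) (λ u → sign (toℕ u))
           (λ r → sign (toℕ r)) (λ r → sign (suc (toℕ r))) (λ u → M Fin.zero (Fin.suc u)) (λ r → M (Fin.suc r) Fin.zero) X
           (λ u r → begin
              sign (suc (toℕ u)) * sign (toℕ r) ≈⟨ *-cong (sign-suc (toℕ u)) refl ⟩
              - sign (toℕ u) * sign (toℕ r)     ≈⟨ sym (-‿distribˡ-* _ _) ⟩
              - (sign (toℕ u) * sign (toℕ r))   ≈⟨ -‿cong (*-comm _ _) ⟩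
              - (sign (toℕ r) * sign (toℕ u))   ≈⟨ -‿distribˡ-* _ _ ⟩
              - sign (toℕ r) * sign (toℕ u)     ≈⟨ *-cong (sym (sign-suc (toℕ r))) refl ⟩
              sign (suc (toℕ r)) * sign (toℕ u) ∎)) ⟩
    T₀ + ∑ (λ r → sign (suc (toℕ r)) * (M (Fin.suc r) Fin.zero * ∑ (λ u → sign (toℕ u) * (M Fin.zero (Fin.suc u) * X r u))))
      ≈⟨ +-cong refl (∑-cong _ _ (λ r → *-cong refl (*-cong refl
           (sym (det-expandFirstRow k (λ a b → M (punchIn (Fin.suc r) a) (Fin.suc b))))))) ⟩
    T₀ + ∑ (λ r → sign (suc (toℕ r)) * (M (Fin.suc r) Fin.zero * det (suc k) (λ a b → M (punchIn (Fin.suc r) a) (Fin.suc b))))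
      ≈⟨ sym (∑-head _) ⟩
    ∑ (λ r → sign (toℕ r) * (M r Fin.zero * det (suc k) (λ a b → M (punchIn r a) (Fin.suc b)))) ∎
    where
      T₀ = sign 0 * (M Fin.zero Fin.zero * det (suc k) (λ r s → M (Fin.suc r) (Fin.suc s)))
      X : Fin (suc k) → Fin (suc k) → Polynomial
      X r u = det k (λ a b → M (Fin.suc (punchIn r a)) (Fin.suc (punchIn u b)))

  det-transpose : ∀ k (M : Matrix k) → det k (λ a b → M b a) ≈ det k M
  det-transpose zero M = refl
  det-transpose (suc k) M = begin
    det (suc k) (λ a b → M b a)
      ≈⟨ det-expandFirstRow k (λ a b → M b a) ⟩
    ∑ (λ j → sign (toℕ j) * (M j Fin.zero * det k (λ r s → M (punchIn j s) (Fin.suc r))))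
      ≈⟨ ∑-cong _ _ (λ j → *-cong refl (*-cong refl (det-transpose k (λ a b → M (punchIn j a) (Fin.suc b))))) ⟩
    ∑ (λ j → sign (toℕ j) * (M j Fin.zero * det k (λ a b → M (punchIn j a) (Fin.suc b))))
      ≈⟨ sym (det-expandFirstColumn k M) ⟩
    det (suc k) M ∎

  punchIn-inject₁-fromℕ : ∀ {k} (u : Fin (suc k)) → punchIn (inject₁ u) (fromℕ k) ≡ fromℕ (suc k)
  punchIn-inject₁-fromℕ {k} Fin.zero = P.refl
  punchIn-inject₁-fromℕ {suc k} (Fin.suc u) = P.cong Fin.suc (punchIn-inject₁-fromℕ u)

  punchIn-inject₁-inject₁ : ∀ {k} (u : Fin (suc k)) (s : Fin k) → punchIn (inject₁ u) (inject₁ s) ≡ inject₁ (punchIn u s)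
  punchIn-inject₁-inject₁ Fin.zero s = P.refl
  punchIn-inject₁-inject₁ (Fin.suc u) Fin.zero = P.refl
  punchIn-inject₁-inject₁ (Fin.suc u) (Fin.suc s) = P.cong Fin.suc (punchIn-inject₁-inject₁ u s)

  punchIn-fromℕ : ∀ {k} (s : Fin k) → punchIn (fromℕ k) s ≡ inject₁ s
  punchIn-fromℕ {suc k} Fin.zero = P.refl
  punchIn-fromℕ {suc k} (Fin.suc s) = P.cong Fin.suc (punchIn-fromℕ s)

  det-expandLastColumn : ∀ k (M : Matrix (suc k)) →
    det (suc k) M ≈ ∑ (λ r → sign (k ℕ.+ toℕ r) * (M r (fromℕ k) * det k (λ a b → M (punchIn r a) (inject₁ b))))
  det-expandLastColumn zero M = trans (det-expandFirstRow 0 M) (∑-cong _ _ (λ { Fin.zero → refl }))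
  det-expandLastColumn (suc k) M = begin
    det (suc (suc k)) M
      ≈⟨ det-expandFirstRow (suc k) M ⟩
    ∑ T
      ≈⟨ ∑-last T ⟩
    ∑ (λ u → T (inject₁ u)) + T L
      ≈⟨ +-cong (∑-cong _ _ (λ u → *-cong (reflexive (P.cong sign (FinP.toℕ-inject₁ u))) (*-cong refl (expandInner u)))) refl ⟩
    ∑ (λ u → sign (toℕ u) * (M Fin.zero (inject₁ u) * ∑ (λ r → sign (k ℕ.+ toℕ r) * (M (Fin.suc r) L * Y r u)))) + T L
      ≈⟨ +-cong (∑∑-exchange (λ u → sign (toℕ u)) (λ u → sign (toℕ u)) (λ r → sign (k ℕ.+ toℕ r))
           (λ r → sign (suc k ℕ.+ suc (toℕ r))) (λ u → M Fin.zero (inject₁ u)) (λ r → M (Fin.suc r) L) Y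
           (λ u r → trans (*-comm _ _) (*-cong (sym (trans (reflexive (P.cong (λ x → sign (suc x)) (ℕP.+-suc k (toℕ r))))
                                                          (sign-suc-suc _))) refl))) refl ⟩
    ∑ (λ r → sign (suc k ℕ.+ suc (toℕ r)) * (M (Fin.suc r) L * ∑ (λ u → sign (toℕ u) * (M Fin.zero (inject₁ u) * Y r u)))) + T L
      ≈⟨ +-comm _ _ ⟩
    T L + ∑ (λ r → sign (suc k ℕ.+ suc (toℕ r)) * (M (Fin.suc r) L * ∑ (λ u → sign (toℕ u) * (M Fin.zero (inject₁ u) * Y r u))))
      ≈⟨ +-cong (*-cong (reflexive (P.cong sign (P.trans (FinP.toℕ-fromℕ (suc k)) (P.sym (ℕP.+-identityʳ (suc k))))))
                  (*-cong refl (det-cong (suc k) (λ a b → reflexive (P.cong (M (Fin.suc a)) (punchIn-fromℕ b))))))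
                (∑-cong _ _ (λ r → *-cong refl (*-cong refl
                  (sym (det-expandFirstRow k (λ a b → M (punchIn (Fin.suc r) a) (inject₁ b))))))) ⟩
    sign (suc k ℕ.+ 0) * (M Fin.zero L * det (suc k) (λ a b → M (Fin.suc a) (inject₁ b)))
      + ∑ (λ r → sign (suc k ℕ.+ suc (toℕ r)) * (M (Fin.suc r) L * det (suc k) (λ a b → M (punchIn (Fin.suc r) a) (inject₁ b))))
      ≈⟨ sym (∑-head _) ⟩
    ∑ (λ r → sign (suc k ℕ.+ toℕ r) * (M r L * det (suc k) (λ a b → M (punchIn r a) (inject₁ b)))) ∎
    where
      L = fromℕ (suc k)
      A : Fin (suc (suc k)) → Matrix (suc k)
      A j r s = M (Fin.suc r) (punchIn j s)
      T : Fin (suc (suc k)) → Polynomial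
      T j = sign (toℕ j) * (M Fin.zero j * det (suc k) (A j))
      Y : Fin (suc k) → Fin (suc k) → Polynomial
      Y r u = det k (λ a b → M (Fin.suc (punchIn r a)) (inject₁ (punchIn u b)))
      expandInner : ∀ u → det (suc k) (A (inject₁ u)) ≈ ∑ (λ r → sign (k ℕ.+ toℕ r) * (M (Fin.suc r) L * Y r u))
      expandInner u = trans (det-expandLastColumn k (A (inject₁ u)))
        (∑-cong _ _ (λ r → *-cong refl (*-cong (reflexive (P.cong (M (Fin.suc r)) (punchIn-inject₁-fromℕ u)))
          (det-cong k (λ a b → reflexive (P.cong (M (Fin.suc (punchIn r a))) (punchIn-inject₁-inject₁ u b)))))))

  det-expandLastRow : ∀ k (M : Matrix (suc k)) →
    det (suc k) M ≈ ∑ (λ t → sign (k ℕ.+ toℕ t) * (M (fromℕ k) t * det k (λ a b → M (inject₁ a) (punchIn t b))))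
  det-expandLastRow k M = begin
    det (suc k) M
      ≈⟨ sym (det-transpose (suc k) M) ⟩
    det (suc k) (λ a b → M b a)
      ≈⟨ det-expandLastColumn k (λ a b → M b a) ⟩
    ∑ (λ t → sign (k ℕ.+ toℕ t) * (M (fromℕ k) t * det k (λ a b → M (inject₁ b) (punchIn t a))))
      ≈⟨ ∑-cong _ _ (λ t → *-cong refl (*-cong refl (det-transpose k (λ a b → M (inject₁ a) (punchIn t b))))) ⟩
    ∑ (λ t → sign (k ℕ.+ toℕ t) * (M (fromℕ k) t * det k (λ a b → M (inject₁ a) (punchIn t b)))) ∎

module Ideal {c ℓ : Level} (κ : Field c ℓ) (n : ℕ) where
  open Poly κ n
  open PolynomialRing κ n using (polynomialRing; ⊕≡+ₚ; ⊗≡*ₚ; ∼⇒≈ₚ)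
  open Determinant κ n
  open CommutativeRing polynomialRing
  open import Relation.Binary.Reasoning.Setoid setoid

  Combination : ∀ {ℓ'} → Pred Polynomial ℓ' → Set (c ⊔ ℓ')
  Combination G = List (Polynomial × Σ Polynomial G)

  opaque
    combination : ∀ {ℓ'} (G : Pred Polynomial ℓ') → Combination G → Polynomial
    combination G cs = sumₚ (L.map (λ t → proj₁ t *ₚ proj₁ (proj₂ t)) cs)

  -- Ideal membership up to the ring equality of `polynomialRing`, which refines ≈ₚ.
  infix 4 _∈ᴵ_
  _∈ᴵ_ : ∀ {ℓ'} → Polynomial → Pred Polynomial ℓ' → Set (c ⊔ ℓ ⊔ ℓ')
  p ∈ᴵ G = Σ (Combination G) λ cs → p ≈ combination G cs

  module _ {ℓ'} (G : Pred Polynomial ℓ') where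
    opaque
      unfolding combination
      combination-def : (cs : Combination G) → combination G cs ≡ sumₚ (L.map (λ t → proj₁ t *ₚ proj₁ (proj₂ t)) cs)
      combination-def cs = P.refl

      combination-∷ : ∀ a g (x : G g) cs → combination G ((a , g , x) ∷ cs) ≈ a * g + combination G cs
      combination-∷ a g x cs = reflexive (P.sym (P.trans (⊕≡+ₚ (a * g) (combination G cs)) (P.cong (_+ₚ combination G cs) (⊗≡*ₚ a g))))

      combination-[] : combination G [] ≈ 0#
      combination-[] = refl

    combination-++ : (cs ds : Combination G) → combination G (cs ++ ds) ≈ combination G cs + combination G ds
    combination-++ [] ds = trans (sym (+-identityˡ _)) (+-cong (sym combination-[]) refl)
    combination-++ ((a , g , x) ∷ cs) ds = begin
      combination G ((a , g , x) ∷ (cs ++ ds))  ≈⟨ combination-∷ a g x (cs ++ ds) ⟩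
      a * g + combination G (cs ++ ds)          ≈⟨ +-cong refl (combination-++ cs ds) ⟩
      a * g + (combination G cs + combination G ds) ≈⟨ sym (+-assoc _ _ _) ⟩
      (a * g + combination G cs) + combination G ds ≈⟨ +-cong (sym (combination-∷ a g x cs)) refl ⟩
      combination G ((a , g , x) ∷ cs) + combination G ds ∎

    scale : Polynomial → Combination G → Combination G
    scale a = L.map (λ t → (a * proj₁ t , proj₂ t))

    combination-scale : ∀ a (cs : Combination G) → combination G (scale a cs) ≈ a * combination G cs
    combination-scale a [] = trans combination-[] (trans (sym (zeroʳ a)) (*-cong refl (sym combination-[])))
    combination-scale a ((b , g , x) ∷ cs) = begin
      combination G ((a * b , g , x) ∷ scale a cs)  ≈⟨ combination-∷ (a * b) g x (scale a cs) ⟩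
      a * b * g + combination G (scale a cs)        ≈⟨ +-cong (*-assoc a b g) (combination-scale a cs) ⟩
      a * (b * g) + a * combination G cs            ≈⟨ sym (distribˡ a _ _) ⟩
      a * (b * g + combination G cs)                ≈⟨ *-cong refl (sym (combination-∷ b g x cs)) ⟩
      a * combination G ((b , g , x) ∷ cs)          ∎

    ∈ᴵ-gen : ∀ {g} → G g → g ∈ᴵ G
    ∈ᴵ-gen {g} x = ((1# , g , x) ∷ []) ,
      sym (trans (combination-∷ 1# g x []) (trans (+-cong refl combination-[]) (trans (+-identityʳ _) (*-identityˡ g))))

    ∈ᴵ-0 : 0# ∈ᴵ G
    ∈ᴵ-0 = [] , sym combination-[]

    ∈ᴵ-+ : ∀ {p q} → p ∈ᴵ G → q ∈ᴵ G → (p + q) ∈ᴵ G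
    ∈ᴵ-+ (cs , p≈) (ds , q≈) = (cs ++ ds) , trans (+-cong p≈ q≈) (sym (combination-++ cs ds))

    ∈ᴵ-* : ∀ a {p} → p ∈ᴵ G → (a * p) ∈ᴵ G
    ∈ᴵ-* a (cs , p≈) = scale a cs , trans (*-cong refl p≈) (sym (combination-scale a cs))

    ∈ᴵ-resp : ∀ {p q} → p ≈ q → q ∈ᴵ G → p ∈ᴵ G
    ∈ᴵ-resp p≈q (cs , q≈) = cs , trans p≈q q≈

    ∈ᴵ-∑ : ∀ {k} (f : Fin k → Polynomial) → (∀ i → f i ∈ᴵ G) → ∑ f ∈ᴵ G
    ∈ᴵ-∑ {zero} f h = ∈ᴵ-resp ∑-empty ∈ᴵ-0
    ∈ᴵ-∑ {suc k} f h = ∈ᴵ-resp (∑-head f) (∈ᴵ-+ (h Fin.zero) (∈ᴵ-∑ (λ i → f (Fin.suc i)) (λ i → h (Fin.suc i))))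

  ∈ᴵ-combination : ∀ {ℓ₁ ℓ₂} {G : Pred Polynomial ℓ₁} {H : Pred Polynomial ℓ₂} →
                   (∀ g → G g → g ∈ᴵ H) → ∀ (cs : Combination G) → combination G cs ∈ᴵ H
  ∈ᴵ-combination {G = G} {H} G⊆H [] = ∈ᴵ-resp H (combination-[] G) (∈ᴵ-0 H)
  ∈ᴵ-combination {G = G} {H} G⊆H ((a , g , x) ∷ cs) =
    ∈ᴵ-resp H (combination-∷ G a g x cs) (∈ᴵ-+ H (∈ᴵ-* H a (G⊆H g x)) (∈ᴵ-combination G⊆H cs))

  ∈ᴵ-trans : ∀ {ℓ₁ ℓ₂} {G : Pred Polynomial ℓ₁} {H : Pred Polynomial ℓ₂} →
             (∀ g → G g → g ∈ᴵ H) → ∀ {p} → p ∈ᴵ G → p ∈ᴵ H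
  ∈ᴵ-trans {H = H} G⊆H (cs , p≈) = ∈ᴵ-resp H p≈ (∈ᴵ-combination G⊆H cs)

  ∈⟨⟩-trans : ∀ {ℓ₁ ℓ₂} {G : Pred Polynomial ℓ₁} {H : Pred Polynomial ℓ₂} →
              (∀ g → G g → g ∈ᴵ H) → ∀ p → p ∈⟨ G ⟩ → p ∈⟨ H ⟩
  ∈⟨⟩-trans {G = G} {H} G⊆H p (cs , p≈) with ∈ᴵ-combination G⊆H cs
  ... | ds , cs≈ds = ds , λ m → Field.trans κ (p≈ m)
        (P.subst₂ _≈ₚ_ (combination-def G cs) (combination-def H ds) (∼⇒≈ₚ cs≈ds) m)

  ∈⟨⟩-mono : ∀ {ℓ₁ ℓ₂} {G : Pred Polynomial ℓ₁} {H : Pred Polynomial ℓ₂} →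
             (∀ g → G g → H g) → ∀ p → p ∈⟨ G ⟩ → p ∈⟨ H ⟩
  ∈⟨⟩-mono {G = G} {H} G⊆H p (cs , p≈) = L.map relabel cs , P.subst (p ≈ₚ_) (P.sym (relabel-sum cs)) p≈
    where
      relabel : Polynomial × Σ Polynomial G → Polynomial × Σ Polynomial H
      relabel (a , g , x) = a , g , G⊆H g x
      relabel-sum : ∀ cs → sumₚ (L.map (λ t → proj₁ t *ₚ proj₁ (proj₂ t)) (L.map relabel cs))
                         ≡ sumₚ (L.map (λ t → proj₁ t *ₚ proj₁ (proj₂ t)) cs)
      relabel-sum [] = P.refl
      relabel-sum ((a , g , x) ∷ cs) = P.cong (a *ₚ g +ₚ_) (relabel-sum cs)

  punchIn-mono-< : ∀ {k} (t : Fin (suc k)) (r s : Fin k) → toℕ r ℕ.< toℕ s → toℕ (punchIn t r) ℕ.< toℕ (punchIn t s)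
  punchIn-mono-< Fin.zero r s lt = ℕ.s≤s lt
  punchIn-mono-< (Fin.suc t) Fin.zero (Fin.suc s) lt = ℕ.s≤s ℕ.z≤n
  punchIn-mono-< (Fin.suc t) (Fin.suc r) (Fin.suc s) (ℕ.s≤s lt) = ℕ.s≤s (punchIn-mono-< t r s lt)

  increasing-punchIn : ∀ {k} (C : Fin (suc k) → Fin n) t → StrictlyIncreasing C → StrictlyIncreasing (λ b → C (punchIn t b))
  increasing-punchIn C t inc r s lt = inc (punchIn t r) (punchIn t s) (punchIn-mono-< t r s lt)

  increasing-inject₁ : ∀ {k} (C : Fin (suc k) → Fin n) → StrictlyIncreasing C → StrictlyIncreasing (λ b → C (inject₁ b))
  increasing-inject₁ C inc r s lt = inc (inject₁ r) (inject₁ s)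
    (P.subst₂ ℕ._<_ (P.sym (FinP.toℕ-inject₁ r)) (P.sym (FinP.toℕ-inject₁ s)) lt)

  minor∈ᴵ-lastRow : ∀ s (R C : Fin (suc s) → Fin n) (i₀ j : Fin n) → StrictlyIncreasing R → StrictlyIncreasing C →
                    (∀ a → toℕ (R (inject₁ a)) ℕ.≤ toℕ i₀) → (∀ b → toℕ (C b) ℕ.≤ toℕ j) →
                    minor (suc s) R C ∈ᴵ IsNWMinor s i₀ j
  minor∈ᴵ-lastRow s R C i₀ j incR incC R≤ C≤ = ∈ᴵ-resp _ (det-expandLastRow s (λ a b → var (R a) (C b)))
    (∈ᴵ-∑ _ _ (λ t → ∈ᴵ-resp _ (sym (*-assoc _ _ _)) (∈ᴵ-* _ _ (∈ᴵ-gen _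
      ((λ a → R (inject₁ a)) , (λ b → C (punchIn t b)) , increasing-inject₁ R incR , increasing-punchIn C t incC ,
       R≤ , (λ b → C≤ (punchIn t b)) , P.refl)))))

  minor∈ᴵ-lastColumn : ∀ s (R C : Fin (suc s) → Fin n) (i j₀ : Fin n) → StrictlyIncreasing R → StrictlyIncreasing C →
                       (∀ a → toℕ (R a) ℕ.≤ toℕ i) → (∀ b → toℕ (C (inject₁ b)) ℕ.≤ toℕ j₀) →
                       minor (suc s) R C ∈ᴵ IsNWMinor s i j₀
  minor∈ᴵ-lastColumn s R C i j₀ incR incC R≤ C≤ = ∈ᴵ-resp _ (det-expandLastColumn s (λ a b → var (R a) (C b)))
    (∈ᴵ-∑ _ _ (λ t → ∈ᴵ-resp _ (sym (*-assoc _ _ _)) (∈ᴵ-* _ _ (∈ᴵ-gen _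
      ((λ a → R (punchIn t a)) , (λ b → C (inject₁ b)) , increasing-punchIn R t incR , increasing-inject₁ C incC ,
       (λ a → R≤ (punchIn t a)) , C≤ , P.refl)))))

module Rank {n : ℕ} where
  open import Data.Bool using (Bool; true; false; _∧_)
  open import Relation.Nullary using (does)
  open import Relation.Nullary.Decidable using (dec-true; dec-false; _×-dec_)
  open import Relation.Unary using (Decidable)
  open ℕP using (_≤?_)
  open P.≡-Reasoning

  bit : Bool → ℕ
  bit true = 1
  bit false = 0

  count : ∀ {m} → (Fin m → Bool) → ℕ
  count {zero} f = 0
  count {suc m} f = bit (f Fin.zero) ℕ.+ count (λ k → f (Fin.suc k))

  length-filter-tabulate : ∀ {A : Set} {p} {Q : Pred A p} (Q? : Decidable Q) {m} (g : Fin m → A) →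
                           L.length (L.filter Q? (L.tabulate g)) ≡ count (λ k → does (Q? (g k)))
  length-filter-tabulate Q? {zero} g = P.refl
  length-filter-tabulate Q? {suc m} g with does (Q? (g Fin.zero))
  ... | true = P.cong suc (length-filter-tabulate Q? (λ k → g (Fin.suc k)))
  ... | false = length-filter-tabulate Q? (λ k → g (Fin.suc k))

  count-cong : ∀ {m} (f g : Fin m → Bool) → (∀ k → f k ≡ g k) → count f ≡ count g
  count-cong {zero} f g eq = P.refl
  count-cong {suc m} f g eq = P.cong₂ ℕ._+_ (P.cong bit (eq Fin.zero)) (count-cong _ _ (λ k → eq (Fin.suc k)))

  count-suc : ∀ {m} (f g : Fin m → Bool) (k₀ : Fin m) → f k₀ ≡ true → g k₀ ≡ false →
              (∀ k → k ≢ k₀ → f k ≡ g k) → count f ≡ suc (count g)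
  count-suc f g Fin.zero f₀ g₀ eq rewrite f₀ | g₀ =
    P.cong suc (count-cong _ _ (λ k → eq (Fin.suc k) (λ ())))
  count-suc f g (Fin.suc k₀) f₀ g₀ eq rewrite eq Fin.zero (λ ()) = begin
    bit (g Fin.zero) ℕ.+ count (λ k → f (Fin.suc k))
      ≡⟨ P.cong (bit (g Fin.zero) ℕ.+_) (count-suc (λ k → f (Fin.suc k)) (λ k → g (Fin.suc k)) k₀ f₀ g₀
           (λ k k≢k₀ → eq (Fin.suc k) (λ e → k≢k₀ (FinP.suc-injective e)))) ⟩
    bit (g Fin.zero) ℕ.+ suc (count (λ k → g (Fin.suc k)))
      ≡⟨ ℕP.+-suc (bit (g Fin.zero)) _ ⟩
    suc (count g) ∎

  count-pos : ∀ {m} (f : Fin m → Bool) (k₀ : Fin m) → f k₀ ≡ true → ∃[ r ] count f ≡ suc r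
  count-pos f Fin.zero f₀ rewrite f₀ = _ , P.refl
  count-pos f (Fin.suc k₀) f₀ with count-pos (λ k → f (Fin.suc k)) k₀ f₀
  ... | r , eq = bit (f Fin.zero) ℕ.+ r , P.trans (P.cong (bit (f Fin.zero) ℕ.+_) eq) (ℕP.+-suc _ r)

  inBox : Permutation′ n → Fin n → Fin n → Fin n → Bool
  inBox u i j k = does (toℕ k ≤? toℕ i) ∧ does (toℕ (u ⟨$⟩ʳ k) ≤? toℕ j)

  rk≡count : ∀ u i j → rk u i j ≡ count (inBox u i j)
  rk≡count u i j = length-filter-tabulate (λ k → (toℕ k ≤? toℕ i) ×-dec (toℕ (u ⟨$⟩ʳ k) ≤? toℕ j)) (λ k → k)

  ≤?-true : ∀ {x y} → x ℕ.≤ y → does (x ≤? y) ≡ true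
  ≤?-true {x} {y} = dec-true (x ≤? y)

  ≤?-false : ∀ {x y} → ¬ (x ℕ.≤ y) → does (x ≤? y) ≡ false
  ≤?-false {x} {y} = dec-false (x ≤? y)

  ≤?-cong : ∀ {x y x' y'} → (x ℕ.≤ y → x' ℕ.≤ y') → (x' ℕ.≤ y' → x ℕ.≤ y) → does (x ≤? y) ≡ does (x' ≤? y')
  ≤?-cong {x} {y} {x'} {y'} f g = by (x ≤? y)
    where
      by : Dec (x ℕ.≤ y) → does (x ≤? y) ≡ does (x' ≤? y')
      by (yes x≤y) = P.trans (≤?-true x≤y) (P.sym (≤?-true (f x≤y)))
      by (no x≰y) = P.trans (≤?-false x≰y) (P.sym (≤?-false (λ x'≤y' → x≰y (g x'≤y'))))

  ≤?-suc-≢ : ∀ (k i : Fin n) (i₀ : ℕ) → toℕ i ≡ suc i₀ → k ≢ i → does (toℕ k ≤? toℕ i) ≡ does (toℕ k ≤? i₀)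
  ≤?-suc-≢ k i i₀ i≡ k≢i = ≤?-cong
    (λ k≤i → ℕP.≤-pred (P.subst (toℕ k ℕ.<_) i≡ (ℕP.≤∧≢⇒< k≤i (λ e → k≢i (FinP.toℕ-injective e)))))
    (λ k≤i₀ → P.subst (toℕ k ℕ.≤_) (P.sym i≡) (ℕP.m≤n⇒m≤1+n k≤i₀))

  suc≰ : ∀ {x} (y : ℕ) → x ≡ suc y → ¬ (x ℕ.≤ y)
  suc≰ y P.refl = ℕP.<-irrefl P.refl

  ≢-image : ∀ (u : Permutation′ n) k j → k ≢ u ⟨$⟩ˡ j → u ⟨$⟩ʳ k ≢ j
  ≢-image u k j k≢ eq = k≢ (P.trans (P.sym (inverseˡ u)) (P.cong (u ⟨$⟩ˡ_) eq))

  rk-row-incr : ∀ u (i i₀ j : Fin n) → toℕ i ≡ suc (toℕ i₀) → toℕ (u ⟨$⟩ʳ i) ℕ.≤ toℕ j → rk u i j ≡ suc (rk u i₀ j)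
  rk-row-incr u i i₀ j i≡ ui≤j = begin
    rk u i j                      ≡⟨ rk≡count u i j ⟩
    count (inBox u i j)           ≡⟨ count-suc _ _ i hit miss same ⟩
    suc (count (inBox u i₀ j))    ≡⟨ P.cong suc (P.sym (rk≡count u i₀ j)) ⟩
    suc (rk u i₀ j)               ∎
    where
      hit : inBox u i j i ≡ true
      hit = P.cong₂ _∧_ (≤?-true {toℕ i} ℕP.≤-refl) (≤?-true ui≤j)
      miss : inBox u i₀ j i ≡ false
      miss = P.cong (_∧ _) (≤?-false (suc≰ (toℕ i₀) i≡))
      same : ∀ k → k ≢ i → inBox u i j k ≡ inBox u i₀ j k
      same k k≢i = P.cong (_∧ _) (≤?-suc-≢ k i (toℕ i₀) i≡ k≢i)

  rk-row-stable : ∀ u (i i₀ j : Fin n) → toℕ i ≡ suc (toℕ i₀) → toℕ j ℕ.< toℕ (u ⟨$⟩ʳ i) → rk u i j ≡ rk u i₀ j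
  rk-row-stable u i i₀ j i≡ j<ui = begin
    rk u i j                ≡⟨ rk≡count u i j ⟩
    count (inBox u i j)     ≡⟨ count-cong _ _ same ⟩
    count (inBox u i₀ j)    ≡⟨ P.sym (rk≡count u i₀ j) ⟩
    rk u i₀ j               ∎
    where
      same : ∀ k → inBox u i j k ≡ inBox u i₀ j k
      same k with k Fin.≟ i
      ... | yes P.refl = P.trans (P.cong (_∧ does (toℕ (u ⟨$⟩ʳ k) ≤? toℕ j)) (≤?-true {toℕ k} ℕP.≤-refl))
                           (P.trans (≤?-false (ℕP.<⇒≱ j<ui))
                             (P.sym (P.cong (_∧ does (toℕ (u ⟨$⟩ʳ k) ≤? toℕ j)) (≤?-false (suc≰ (toℕ i₀) i≡)))))
      ... | no k≢i = P.cong (_∧ _) (≤?-suc-≢ k i (toℕ i₀) i≡ k≢i)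

  rk-col-incr : ∀ u (i j j₀ : Fin n) → toℕ j ≡ suc (toℕ j₀) → toℕ (u ⟨$⟩ˡ j) ℕ.≤ toℕ i → rk u i j ≡ suc (rk u i j₀)
  rk-col-incr u i j j₀ j≡ u⁻¹j≤i = begin
    rk u i j                      ≡⟨ rk≡count u i j ⟩
    count (inBox u i j)           ≡⟨ count-suc _ _ (u ⟨$⟩ˡ j) hit miss same ⟩
    suc (count (inBox u i j₀))    ≡⟨ P.cong suc (P.sym (rk≡count u i j₀)) ⟩
    suc (rk u i j₀)               ∎
    where
      uu⁻¹j≡j : toℕ (u ⟨$⟩ʳ (u ⟨$⟩ˡ j)) ≡ toℕ j
      uu⁻¹j≡j = P.cong toℕ (inverseʳ u)
      hit : inBox u i j (u ⟨$⟩ˡ j) ≡ true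
      hit = P.cong₂ _∧_ (≤?-true u⁻¹j≤i) (≤?-true (ℕP.≤-reflexive uu⁻¹j≡j))
      miss : inBox u i j₀ (u ⟨$⟩ˡ j) ≡ false
      miss = P.cong₂ _∧_ (≤?-true u⁻¹j≤i) (≤?-false (suc≰ (toℕ j₀) (P.trans uu⁻¹j≡j j≡)))
      same : ∀ k → k ≢ u ⟨$⟩ˡ j → inBox u i j k ≡ inBox u i j₀ k
      same k k≢ = P.cong (_ ∧_) (≤?-suc-≢ (u ⟨$⟩ʳ k) j (toℕ j₀) j≡ (≢-image u k j k≢))

  rk-col-stable : ∀ u (i j j₀ : Fin n) → toℕ j ≡ suc (toℕ j₀) → toℕ i ℕ.< toℕ (u ⟨$⟩ˡ j) → rk u i j ≡ rk u i j₀
  rk-col-stable u i j j₀ j≡ i<u⁻¹j = begin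
    rk u i j                ≡⟨ rk≡count u i j ⟩
    count (inBox u i j)     ≡⟨ count-cong _ _ same ⟩
    count (inBox u i j₀)    ≡⟨ P.sym (rk≡count u i j₀) ⟩
    rk u i j₀               ∎
    where
      same : ∀ k → inBox u i j k ≡ inBox u i j₀ k
      same k with k Fin.≟ u ⟨$⟩ˡ j
      ... | yes P.refl = P.trans (P.cong (_∧ _) (≤?-false (ℕP.<⇒≱ i<u⁻¹j)))
                           (P.sym (P.cong (_∧ _) (≤?-false (ℕP.<⇒≱ i<u⁻¹j))))
      ... | no k≢ = P.cong (_ ∧_) (≤?-suc-≢ (u ⟨$⟩ʳ k) j (toℕ j₀) j≡ (≢-image u k j k≢))

  inBox-cong : ∀ {u u'} (i j k : Fin n) → u ⟨$⟩ʳ k ≡ u' ⟨$⟩ʳ k → inBox u i j k ≡ inBox u' i j k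
  inBox-cong i j k eq = P.cong (λ x → does (toℕ k ≤? toℕ i) ∧ does (toℕ x ≤? toℕ j)) eq

  inBox-false : ∀ u (i j k : Fin n) → (toℕ k ℕ.≤ toℕ i → toℕ (u ⟨$⟩ʳ k) ℕ.≤ toℕ j → ⊥) → inBox u i j k ≡ false
  inBox-false u i j k notBoth = by (toℕ k ≤? toℕ i)
    where
      by : Dec (toℕ k ℕ.≤ toℕ i) → inBox u i j k ≡ false
      by (yes k≤i) = P.trans (P.cong (_∧ does (toℕ (u ⟨$⟩ʳ k) ≤? toℕ j)) (≤?-true k≤i)) (≤?-false (notBoth k≤i))
      by (no k≰i) = P.cong (_∧ does (toℕ (u ⟨$⟩ʳ k) ≤? toℕ j)) (≤?-false k≰i)

  rk-pos-row : ∀ u (i j : Fin n) → toℕ (u ⟨$⟩ʳ i) ℕ.≤ toℕ j → ∃[ r ] rk u i j ≡ suc r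
  rk-pos-row u i j ui≤j with count-pos (inBox u i j) i (P.cong₂ _∧_ (≤?-true {toℕ i} ℕP.≤-refl) (≤?-true ui≤j))
  ... | r , eq = r , P.trans (rk≡count u i j) eq

  rk-pos-col : ∀ u (i j : Fin n) → toℕ (u ⟨$⟩ˡ j) ℕ.≤ toℕ i → ∃[ r ] rk u i j ≡ suc r
  rk-pos-col u i j u⁻¹j≤i
    with count-pos (inBox u i j) (u ⟨$⟩ˡ j) (P.cong₂ _∧_ (≤?-true u⁻¹j≤i) (≤?-true (ℕP.≤-reflexive (P.cong toℕ (inverseʳ u)))))
  ... | r , eq = r , P.trans (rk≡count u i j) eq

module EssentialSet {n : ℕ} where
  open Rank {n}
  open import Relation.Nullary.Decidable using (_×-dec_)

  InD? : ∀ u (i j : Fin n) → Dec (InD u i j)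
  InD? u i j = (toℕ j ℕP.<? toℕ (u ⟨$⟩ʳ i)) ×-dec (toℕ i ℕP.<? toℕ (u ⟨$⟩ˡ j))

  zero⊎suc : ∀ {m} (x : Fin m) → (toℕ x ≡ 0) ⊎ (Σ (Fin m) λ y → toℕ x ≡ suc (toℕ y))
  zero⊎suc Fin.zero = inj₁ P.refl
  zero⊎suc (Fin.suc y) = inj₂ (inject₁ y , P.cong suc (P.sym (FinP.toℕ-inject₁ y)))

  predecessor : ∀ {m} {x y : Fin m} → toℕ x ℕ.< toℕ y → Σ (Fin m) λ y₀ → toℕ y ≡ suc (toℕ y₀)
  predecessor {y = Fin.suc y₀} _ = inject₁ y₀ , P.cong suc (P.sym (FinP.toℕ-inject₁ y₀))

  successor? : (x : Fin n) → (∃[ y ] toℕ y ≡ suc (toℕ x)) ⊎ (∀ y → toℕ y ≢ suc (toℕ x))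
  successor? x with suc (toℕ x) ℕP.<? n
  ... | yes lt = inj₁ (Fin.fromℕ< lt , FinP.toℕ-fromℕ< lt)
  ... | no nlt = inj₂ (λ y eq → nlt (P.subst (ℕ._< n) eq (FinP.toℕ<n y)))

  belowInD? : ∀ u (i j : Fin n) → (∃[ i' ] toℕ i' ≡ suc (toℕ i) × InD u i' j) ⊎ (∀ i' → toℕ i' ≡ suc (toℕ i) → ¬ InD u i' j)
  belowInD? u i j with successor? i
  ... | inj₂ none = inj₂ (λ i' eq _ → none i' eq)
  ... | inj₁ (i' , eq) with InD? u i' j
  ...   | yes d = inj₁ (i' , eq , d)
  ...   | no nd = inj₂ (λ i'' eq' d → nd (P.subst (λ z → InD u z j) (FinP.toℕ-injective (P.trans eq' (P.sym eq))) d))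

  rightInD? : ∀ u (i j : Fin n) → (∃[ j' ] toℕ j' ≡ suc (toℕ j) × InD u i j') ⊎ (∀ j' → toℕ j' ≡ suc (toℕ j) → ¬ InD u i j')
  rightInD? u i j with successor? j
  ... | inj₂ none = inj₂ (λ j' eq _ → none j' eq)
  ... | inj₁ (j' , eq) with InD? u i j'
  ...   | yes d = inj₁ (j' , eq , d)
  ...   | no nd = inj₂ (λ j'' eq' d → nd (P.subst (λ z → InD u i z) (FinP.toℕ-injective (P.trans eq' (P.sym eq))) d))

  EssentialSE : Permutation′ n → Fin n → Fin n → Set
  EssentialSE u i j = ∃[ i' ] ∃[ j' ] InEss u i' j' × toℕ i ℕ.≤ toℕ i' × toℕ j ℕ.≤ toℕ j' × rk u i' j' ≡ rk u i j

  distToEdge : Fin n → ℕ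
  distToEdge x = n ∸ toℕ x

  ∸-suc : ∀ m x → x ℕ.< m → m ∸ x ≡ suc (m ∸ suc x)
  ∸-suc (suc m) zero _ = P.refl
  ∸-suc (suc m) (suc x) (ℕ.s≤s x<m) = ∸-suc m x x<m

  distToEdge-suc : ∀ (x y : Fin n) → toℕ y ≡ suc (toℕ x) → distToEdge x ≡ suc (distToEdge y)
  distToEdge-suc x y eq = P.trans (∸-suc n (toℕ x) (FinP.toℕ<n x)) (P.cong (λ z → suc (n ∸ z)) (P.sym eq))

  -- Walk down inside D(u) while possible, otherwise right; the rank is constant along the
  -- walk, and it stops at an essential box.
  essentialSE-acc : ∀ f u (i j : Fin n) → distToEdge i ℕ.+ distToEdge j ℕ.< f → InD u i j → EssentialSE u i j
  essentialSE-acc (suc f) u i j lt d with belowInD? u i j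
  ... | inj₁ (i' , i'≡ , d') with essentialSE-acc f u i' j fuel d'
    where fuel = ℕP.≤-pred (P.subst (λ x → x ℕ.+ distToEdge j ℕ.< suc f) (distToEdge-suc i i' i'≡) lt)
  ...   | i'' , j'' , ess , i'≤ , j≤ , rk≡ =
    i'' , j'' , ess , ℕP.≤-trans (ℕP.n≤1+n (toℕ i)) (P.subst (ℕ._≤ toℕ i'') i'≡ i'≤) , j≤ ,
    P.trans rk≡ (rk-row-stable u i' i j i'≡ (proj₁ d'))
  essentialSE-acc (suc f) u i j lt d | inj₂ notBelow with rightInD? u i j
  ... | inj₁ (j' , j'≡ , d') with essentialSE-acc f u i j' fuel d'
    where fuel = ℕP.≤-pred (P.subst (ℕ._< suc f) (ℕP.+-suc (distToEdge i) (distToEdge j'))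
                   (P.subst (λ x → distToEdge i ℕ.+ x ℕ.< suc f) (distToEdge-suc j j' j'≡) lt))
  ...   | i'' , j'' , ess , i≤ , j'≤ , rk≡ =
    i'' , j'' , ess , i≤ , ℕP.≤-trans (ℕP.n≤1+n (toℕ j)) (P.subst (ℕ._≤ toℕ j'') j'≡ j'≤) ,
    P.trans rk≡ (rk-col-stable u i j' j j'≡ (proj₂ d'))
  essentialSE-acc (suc f) u i j lt d | inj₂ notBelow | inj₂ notRight =
    i , j , (d , notBelow , notRight) , ℕP.≤-refl , ℕP.≤-refl , P.refl

  essentialSE : ∀ u (i j : Fin n) → InD u i j → EssentialSE u i j
  essentialSE u i j = essentialSE-acc _ u i j ℕP.≤-refl

module Fulton {c ℓ : Level} (κ : Field c ℓ) (n : ℕ) where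
  open Poly κ n
  open Ideal κ n
  open Rank {n}
  open EssentialSet {n}

  IsNWMinor-widen : ∀ {k} {i j i' j' : Fin n} {p} → IsNWMinor k i j p →
                    toℕ i ℕ.≤ toℕ i' → toℕ j ℕ.≤ toℕ j' → IsNWMinor k i' j' p
  IsNWMinor-widen (R , C , incR , incC , R≤ , C≤ , eq) i≤ j≤ =
    R , C , incR , incC , (λ a → ℕP.≤-trans (R≤ a) i≤) , (λ b → ℕP.≤-trans (C≤ b) j≤) , eq

  inject₁<fromℕ : ∀ s (a : Fin s) → toℕ (inject₁ a) ℕ.< toℕ (fromℕ s)
  inject₁<fromℕ s a = P.subst₂ ℕ._<_ (P.sym (FinP.toℕ-inject₁ a)) (P.sym (FinP.toℕ-fromℕ s)) (FinP.toℕ<n a)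

  ¬IsNWMinor-firstRow : ∀ {r} {i j : Fin n} {p} → toℕ i ≡ 0 → ¬ IsNWMinor (suc (suc r)) i j p
  ¬IsNWMinor-firstRow i≡0 (R , C , incR , incC , R≤ , C≤ , _) =
    ℕP.n≮0 (ℕP.<-≤-trans (incR Fin.zero (Fin.suc Fin.zero) (ℕ.s≤s ℕ.z≤n)) (P.subst (_ ℕ.≤_) i≡0 (R≤ (Fin.suc Fin.zero))))

  ¬IsNWMinor-firstColumn : ∀ {r} {i j : Fin n} {p} → toℕ j ≡ 0 → ¬ IsNWMinor (suc (suc r)) i j p
  ¬IsNWMinor-firstColumn j≡0 (R , C , incR , incC , R≤ , C≤ , _) =
    ℕP.n≮0 (ℕP.<-≤-trans (incC Fin.zero (Fin.suc Fin.zero) (ℕ.s≤s ℕ.z≤n)) (P.subst (_ ℕ.≤_) j≡0 (C≤ (Fin.suc Fin.zero))))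

  IsNWMinor-shrinkRow : ∀ {s} {i i₀ j : Fin n} {p} → toℕ i ≡ suc (toℕ i₀) →
                        IsNWMinor (suc s) i j p → p ∈ᴵ IsNWMinor s i₀ j
  IsNWMinor-shrinkRow {s} {i₀ = i₀} i≡ (R , C , incR , incC , R≤ , C≤ , P.refl) =
    minor∈ᴵ-lastRow s R C i₀ _ incR incC
      (λ a → ℕP.≤-pred (P.subst (_ ℕ.<_) i≡ (ℕP.<-≤-trans (incR _ _ (inject₁<fromℕ s a)) (R≤ (fromℕ s))))) C≤

  IsNWMinor-shrinkColumn : ∀ {s} {i j j₀ : Fin n} {p} → toℕ j ≡ suc (toℕ j₀) →
                           IsNWMinor (suc s) i j p → p ∈ᴵ IsNWMinor s i j₀
  IsNWMinor-shrinkColumn {s} {j₀ = j₀} j≡ (R , C , incR , incC , R≤ , C≤ , P.refl) =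
    minor∈ᴵ-lastColumn s R C _ j₀ incR incC R≤
      (λ b → ℕP.≤-pred (P.subst (_ ℕ.<_) j≡ (ℕP.<-≤-trans (incC _ _ (inject₁<fromℕ s b)) (C≤ (fromℕ s)))))

  IsNWMinor-rank : ∀ {k k'} {i j : Fin n} {p} → k ≡ k' → IsNWMinor (suc k) i j p → IsNWMinor (suc k') i j p
  IsNWMinor-rank P.refl nw = nw

  schubertGen∈ᴵfultonGen-acc : ∀ f u (i j : Fin n) → toℕ i ℕ.+ toℕ j ℕ.< f →
                               ∀ p → IsNWMinor (suc (rk u i j)) i j p → p ∈ᴵ FultonGen u
  schubertGen∈ᴵfultonGen-acc (suc f) u i j lt p nw with InD? u i j
  ... | yes d with essentialSE u i j d
  ...   | i' , j' , ess , i≤ , j≤ , rk≡ =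
    ∈ᴵ-gen _ (i' , j' , ess , IsNWMinor-rank (P.sym rk≡) (IsNWMinor-widen nw i≤ j≤))
  schubertGen∈ᴵfultonGen-acc (suc f) u i j lt p nw | no ¬d with toℕ j ℕP.<? toℕ (u ⟨$⟩ʳ i)
  ... | no j≮ui = rowCase (zero⊎suc i)
    where
      ui≤j = ℕP.≮⇒≥ j≮ui
      rowCase : (toℕ i ≡ 0) ⊎ (Σ (Fin n) λ i₀ → toℕ i ≡ suc (toℕ i₀)) → p ∈ᴵ FultonGen u
      rowCase (inj₁ i≡0) = ⊥-elim (¬IsNWMinor-firstRow i≡0 (IsNWMinor-rank (proj₂ (rk-pos-row u i j ui≤j)) nw))
      rowCase (inj₂ (i₀ , i≡)) =
        ∈ᴵ-trans (schubertGen∈ᴵfultonGen-acc f u i₀ j fuel)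
          (IsNWMinor-shrinkRow i≡ (IsNWMinor-rank (rk-row-incr u i i₀ j i≡ ui≤j) nw))
        where fuel = ℕP.≤-pred (P.subst (λ x → x ℕ.+ toℕ j ℕ.< suc f) i≡ lt)
  ... | yes j<ui = columnCase (zero⊎suc j)
    where
      u⁻¹j≤i = ℕP.≮⇒≥ (λ i<u⁻¹j → ¬d (j<ui , i<u⁻¹j))
      columnCase : (toℕ j ≡ 0) ⊎ (Σ (Fin n) λ j₀ → toℕ j ≡ suc (toℕ j₀)) → p ∈ᴵ FultonGen u
      columnCase (inj₁ j≡0) = ⊥-elim (¬IsNWMinor-firstColumn j≡0 (IsNWMinor-rank (proj₂ (rk-pos-col u i j u⁻¹j≤i)) nw))
      columnCase (inj₂ (j₀ , j≡)) =
        ∈ᴵ-trans (schubertGen∈ᴵfultonGen-acc f u i j₀ fuel)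
          (IsNWMinor-shrinkColumn j≡ (IsNWMinor-rank (rk-col-incr u i j j₀ j≡ u⁻¹j≤i) nw))
        where fuel = ℕP.≤-pred (P.subst (ℕ._< suc f) (ℕP.+-suc (toℕ i) (toℕ j₀))
                       (P.subst (λ x → toℕ i ℕ.+ x ℕ.< suc f) j≡ lt))

  schubertGen∈ᴵfultonGen : ∀ u p → SchubertGen u p → p ∈ᴵ FultonGen u
  schubertGen∈ᴵfultonGen u p (i , j , nw) = schubertGen∈ᴵfultonGen-acc _ u i j ℕP.≤-refl p nw

module CornerSwap {n : ℕ} (w : Permutation′ n) (a b : Fin n) (corner : LowerOutsideCorner w a b) where
  open Rank {n}
  open import Relation.Nullary.Decidable using (dec-true; dec-false)

  p q : Fin n
  p = w ⟨$⟩ˡ b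
  q = w ⟨$⟩ʳ a

  v : Permutation′ n
  v = swapPositions w a p

  b<q : toℕ b ℕ.< toℕ q
  b<q = proj₁ (proj₁ corner)

  a<p : toℕ a ℕ.< toℕ p
  a<p = proj₂ (proj₁ corner)

  cornerOf : ∀ c d → InD w c d → toℕ a ℕ.≤ toℕ c → toℕ b ℕ.≤ toℕ d → c ≡ a × d ≡ b
  cornerOf = proj₂ corner

  p≢a : p ≢ a
  p≢a eq = ℕP.<-irrefl (P.cong toℕ (P.sym eq)) a<p

  v-a : v ⟨$⟩ʳ a ≡ b
  v-a rewrite dec-true (a Fin.≟ a) P.refl = inverseʳ w

  v-p : v ⟨$⟩ʳ p ≡ q
  v-p rewrite dec-false (p Fin.≟ a) p≢a | dec-true (p Fin.≟ p) P.refl = P.refl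

  v-other : ∀ k → k ≢ a → k ≢ p → v ⟨$⟩ʳ k ≡ w ⟨$⟩ʳ k
  v-other k k≢a k≢p rewrite dec-false (k Fin.≟ a) k≢a | dec-false (k Fin.≟ p) k≢p = P.refl

  v⁻¹-b : v ⟨$⟩ˡ b ≡ a
  v⁻¹-b = P.trans (P.cong (v ⟨$⟩ˡ_) (P.sym v-a)) (inverseˡ v)

  v⁻¹-q : v ⟨$⟩ˡ q ≡ p
  v⁻¹-q = P.trans (P.cong (v ⟨$⟩ˡ_) (P.sym v-p)) (inverseˡ v)

  v⁻¹-other : ∀ j → j ≢ b → j ≢ q → v ⟨$⟩ˡ j ≡ w ⟨$⟩ˡ j
  v⁻¹-other j j≢b j≢q = P.trans (P.cong (v ⟨$⟩ˡ_) (P.sym (P.trans (v-other k k≢a k≢p) (inverseʳ w)))) (inverseˡ v)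
    where
      k = w ⟨$⟩ˡ j
      k≢a : k ≢ a
      k≢a eq = j≢q (P.trans (P.sym (inverseʳ w)) (P.cong (w ⟨$⟩ʳ_) eq))
      k≢p : k ≢ p
      k≢p eq = j≢b (P.trans (P.sym (inverseʳ w)) (P.trans (P.cong (w ⟨$⟩ʳ_) eq) (inverseʳ w)))

  which : (k x y : Fin n) → k ≡ x ⊎ k ≡ y ⊎ (k ≢ x × k ≢ y)
  which k x y with k Fin.≟ x | k Fin.≟ y
  ... | yes eq | _ = inj₁ eq
  ... | no _ | yes eq = inj₂ (inj₁ eq)
  ... | no k≢x | no k≢y = inj₂ (inj₂ (k≢x , k≢y))

  NorthOrWest : Fin n → Fin n → Set
  NorthOrWest i j = toℕ i ℕ.< toℕ a ⊎ toℕ j ℕ.< toℕ b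

  ¬southEast : ∀ {i j} → NorthOrWest i j → toℕ a ℕ.≤ toℕ i → toℕ b ℕ.≤ toℕ j → ⊥
  ¬southEast (inj₁ i<a) a≤i b≤j = ℕP.<⇒≱ i<a a≤i
  ¬southEast (inj₂ j<b) a≤i b≤j = ℕP.<⇒≱ j<b b≤j

  -- Everything of D(v) weakly southeast of (a,b) would be a box of D(w) southeast of the
  -- lower outside corner.
  ¬InD-v-southEast : ∀ i j → InD v i j → toℕ a ℕ.≤ toℕ i → toℕ b ℕ.≤ toℕ j → ⊥
  ¬InD-v-southEast i j (j<vi , i<v⁻¹j) a≤i b≤j with which i a p | which j b q
  ... | inj₁ P.refl | _ = ℕP.<⇒≱ (P.subst (λ x → toℕ j ℕ.< toℕ x) v-a j<vi) b≤j
  ... | inj₂ (inj₁ P.refl) | inj₁ P.refl = ℕP.<-asym a<p (P.subst (λ x → toℕ p ℕ.< toℕ x) v⁻¹-b i<v⁻¹j)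
  ... | inj₂ (inj₁ P.refl) | inj₂ (inj₁ P.refl) = ℕP.<-irrefl P.refl (P.subst (λ x → toℕ q ℕ.< toℕ x) v-p j<vi)
  ... | inj₂ (inj₁ P.refl) | inj₂ (inj₂ (j≢b , j≢q)) = j≢b (proj₂ (cornerOf a j aj∈D ℕP.≤-refl b≤j))
    where
      aj∈D : InD w a j
      aj∈D = P.subst (λ x → toℕ j ℕ.< toℕ x) v-p j<vi ,
             ℕP.<-trans a<p (P.subst (λ x → toℕ p ℕ.< toℕ x) (v⁻¹-other j j≢b j≢q) i<v⁻¹j)
  ... | inj₂ (inj₂ (i≢a , i≢p)) | inj₁ P.refl = ℕP.<⇒≱ (P.subst (λ x → toℕ i ℕ.< toℕ x) v⁻¹-b i<v⁻¹j) a≤i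
  ... | inj₂ (inj₂ (i≢a , i≢p)) | inj₂ (inj₁ P.refl) = i≢a (proj₁ (cornerOf i b ib∈D a≤i ℕP.≤-refl))
    where
      ib∈D : InD w i b
      ib∈D = ℕP.<-trans b<q (P.subst (λ x → toℕ q ℕ.< toℕ x) (v-other i i≢a i≢p) j<vi) ,
             P.subst (λ x → toℕ i ℕ.< toℕ x) v⁻¹-q i<v⁻¹j
  ... | inj₂ (inj₂ (i≢a , i≢p)) | inj₂ (inj₂ (j≢b , j≢q)) = i≢a (proj₁ (cornerOf i j ij∈D a≤i b≤j))
    where
      ij∈D : InD w i j
      ij∈D = P.subst (λ x → toℕ j ℕ.< toℕ x) (v-other i i≢a i≢p) j<vi ,
             P.subst (λ x → toℕ i ℕ.< toℕ x) (v⁻¹-other j j≢b j≢q) i<v⁻¹j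

  northOrWest? : ∀ i j → NorthOrWest i j ⊎ (toℕ a ℕ.≤ toℕ i × toℕ b ℕ.≤ toℕ j)
  northOrWest? i j with toℕ i ℕP.<? toℕ a | toℕ j ℕP.<? toℕ b
  ... | yes i<a | _ = inj₁ (inj₁ i<a)
  ... | no _ | yes j<b = inj₁ (inj₂ j<b)
  ... | no i≮a | no j≮b = inj₂ (ℕP.≮⇒≥ i≮a , ℕP.≮⇒≥ j≮b)

  InD-v⇒northOrWest : ∀ i j → InD v i j → NorthOrWest i j
  InD-v⇒northOrWest i j d with northOrWest? i j
  ... | inj₁ nw = nw
  ... | inj₂ (a≤i , b≤j) = ⊥-elim (¬InD-v-southEast i j d a≤i b≤j)

  below-w : ∀ i j → NorthOrWest i j → toℕ j ℕ.< toℕ (v ⟨$⟩ʳ i) → toℕ j ℕ.< toℕ (w ⟨$⟩ʳ i)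
  below-w i j nw j<vi with which i a p
  ... | inj₁ P.refl = ℕP.<-trans (P.subst (λ x → toℕ j ℕ.< toℕ x) v-a j<vi) b<q
  ... | inj₂ (inj₁ P.refl) = westOf nw
    where
      westOf : NorthOrWest p j → toℕ j ℕ.< toℕ (w ⟨$⟩ʳ p)
      westOf (inj₁ p<a) = ⊥-elim (ℕP.<-asym p<a a<p)
      westOf (inj₂ j<b) = P.subst (λ x → toℕ j ℕ.< toℕ x) (P.sym (inverseʳ w)) j<b
  ... | inj₂ (inj₂ (i≢a , i≢p)) = P.subst (λ x → toℕ j ℕ.< toℕ x) (v-other i i≢a i≢p) j<vi

  right-w : ∀ i j → NorthOrWest i j → toℕ i ℕ.< toℕ (v ⟨$⟩ˡ j) → toℕ i ℕ.< toℕ (w ⟨$⟩ˡ j)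
  right-w i j nw i<v⁻¹j with which j b q
  ... | inj₁ P.refl = ℕP.<-trans (P.subst (λ x → toℕ i ℕ.< toℕ x) v⁻¹-b i<v⁻¹j) a<p
  ... | inj₂ (inj₁ P.refl) = northOf nw
    where
      northOf : NorthOrWest i q → toℕ i ℕ.< toℕ (w ⟨$⟩ˡ q)
      northOf (inj₁ i<a) = P.subst (λ x → toℕ i ℕ.< toℕ x) (P.sym (inverseˡ w)) i<a
      northOf (inj₂ q<b) = ⊥-elim (ℕP.<-asym q<b b<q)
  ... | inj₂ (inj₂ (j≢b , j≢q)) = P.subst (λ x → toℕ i ℕ.< toℕ x) (v⁻¹-other j j≢b j≢q) i<v⁻¹j

  InD-v⇒InD-w : ∀ i j → InD v i j → InD w i j
  InD-v⇒InD-w i j d@(j<vi , i<v⁻¹j) = below-w i j nw j<vi , right-w i j nw i<v⁻¹j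
    where nw = InD-v⇒northOrWest i j d

  -- North or west of (a,b) neither a nor p is counted by rk, for v or for w.
  rk-v≡rk-w : ∀ i j → NorthOrWest i j → rk v i j ≡ rk w i j
  rk-v≡rk-w i j nw = P.trans (rk≡count v i j) (P.trans (count-cong _ _ same) (P.sym (rk≡count w i j)))
    where
      notSE = ¬southEast nw
      ≤j : ∀ {x y} → x ≡ y → toℕ x ℕ.≤ toℕ j → toℕ y ℕ.≤ toℕ j
      ≤j eq = P.subst (λ z → toℕ z ℕ.≤ toℕ j) eq
      same : ∀ k → inBox v i j k ≡ inBox w i j k
      same k with which k a p
      ... | inj₁ P.refl = P.trans
        (inBox-false v i j a (λ a≤i va≤j → notSE a≤i (≤j v-a va≤j)))
        (P.sym (inBox-false w i j a (λ a≤i q≤j → notSE a≤i (ℕP.≤-trans (ℕP.<⇒≤ b<q) q≤j))))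
      ... | inj₂ (inj₁ P.refl) = P.trans
        (inBox-false v i j p (λ p≤i vp≤j → notSE (ℕP.≤-trans (ℕP.<⇒≤ a<p) p≤i) (ℕP.≤-trans (ℕP.<⇒≤ b<q) (≤j v-p vp≤j))))
        (P.sym (inBox-false w i j p (λ p≤i wp≤j → notSE (ℕP.≤-trans (ℕP.<⇒≤ a<p) p≤i) (≤j (inverseʳ w) wp≤j))))
      ... | inj₂ (inj₂ (k≢a , k≢p)) = inBox-cong {v} {w} i j k (v-other k k≢a k≢p)

module Coefficient {c ℓ : Level} (κ : Field c ℓ) (n : ℕ) where
  open Poly κ n
  open Field κ
  open PolynomialRing κ n
  open Determinant κ n
  open Ideal κ n using (increasing-inject₁)
  module R = CommutativeRing polynomialRing
  open import Relation.Binary.Reasoning.Setoid setoid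
  open import Algebra.Properties.Ring ring using (-‿distribˡ-*; -‿involutive)

  firstMonomial : Polynomial → Monomial
  firstMonomial [] = oneMon
  firstMonomial ((_ , m) ∷ _) = m

  varMonomial : Fin n → Fin n → Monomial
  varMonomial x y = firstMonomial (var x y)

  varMonomial-self : ∀ x y → varMonomial x y x y ≡ 1
  varMonomial-self x y with x Fin.≟ x | y Fin.≟ y
  ... | yes _ | yes _ = P.refl
  ... | no x≢x | _ = ⊥-elim (x≢x P.refl)
  ... | yes _ | no y≢y = ⊥-elim (y≢y P.refl)

  varMonomial-otherRow : ∀ x y k l → k ≢ x → varMonomial x y k l ≡ 0
  varMonomial-otherRow x y k l k≢x with k Fin.≟ x
  ... | yes eq = ⊥-elim (k≢x eq)
  ... | no _ = P.refl

  varMonomial-otherColumn : ∀ x y k l → l ≢ y → varMonomial x y k l ≡ 0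
  varMonomial-otherColumn x y k l l≢y with k Fin.≟ x | l Fin.≟ y
  ... | _ | yes eq = ⊥-elim (l≢y eq)
  ... | yes _ | no _ = P.refl
  ... | no _ | no _ = P.refl

  coefficient : Monomial → Polynomial → Carrier
  coefficient m p = ⟦ p ⟧ (indicator m)

  coefficient-cong : ∀ m {p q} → p R.≈ q → coefficient m p ≈ coefficient m q
  coefficient-cong m p∼q = run p∼q (indicator m) (indicator-respects m)

  coefficient-+ : ∀ m p q → coefficient m (p R.+ q) ≈ coefficient m p + coefficient m q
  coefficient-+ m p q rewrite ⊕≡+ₚ p q = ⟦++⟧ p q (indicator m)

  coefficient-neg : ∀ m p → coefficient m (R.- p) ≈ - coefficient m p
  coefficient-neg m p rewrite ⊖≡-ₚ p = ⟦-ₚ⟧ p (indicator m)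

  coefficient-var* : ∀ m x y Q → coefficient m (var x y R.* Q) ≈ ⟦ Q ⟧ (λ m₂ → indicator m (varMonomial x y +ₘ m₂))
  coefficient-var* m x y Q rewrite ⊗≡*ₚ (var x y) Q =
    trans (⟦*ₚ⟧ (var x y) Q (indicator m)) (trans (+-identityʳ _) (*-identityˡ _))

  coefficient-1 : coefficient oneMon 1ₚ ≈ 1#
  coefficient-1 with oneMon ≟ₘ oneMon
  ... | yes _ = trans (+-identityʳ _) (*-identityˡ _)
  ... | no ≢ = ⊥-elim (≢ (λ i j → P.refl))

  coefficient-var*-divisible : ∀ m x y m' Q → m ≗ₘ (varMonomial x y +ₘ m') →
                               coefficient m (var x y R.* Q) ≈ coefficient m' Q
  coefficient-var*-divisible m x y m' Q m≗ = trans (coefficient-var* m x y Q) (⟦⟧-cong Q shift)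
    where
      shift : ∀ m₂ → indicator m (varMonomial x y +ₘ m₂) ≈ indicator m' m₂
      shift m₂ with (varMonomial x y +ₘ m₂) ≟ₘ m | m₂ ≟ₘ m'
      ... | yes _ | yes _ = refl
      ... | no _ | no _ = refl
      ... | yes eq | no ≢ = ⊥-elim (≢ (λ i j → ℕP.+-cancelˡ-≡ (varMonomial x y i j) _ _ (P.trans (eq i j) (m≗ i j))))
      ... | no ≢ | yes eq = ⊥-elim (≢ (λ i j → P.trans (P.cong (varMonomial x y i j ℕ.+_) (eq i j)) (P.sym (m≗ i j))))

  coefficient-var*-absent : ∀ m x y Q → m x y ≡ 0 → coefficient m (var x y R.* Q) ≈ 0#
  coefficient-var*-absent m x y Q m₀ = trans (coefficient-var* m x y Q) (trans (⟦⟧-cong Q vanish) (⟦⟧-0 Q))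
    where
      vanish : ∀ m₂ → indicator m (varMonomial x y +ₘ m₂) ≈ 0#
      vanish m₂ with (varMonomial x y +ₘ m₂) ≟ₘ m
      ... | no _ = refl
      ... | yes eq with P.trans (P.sym (P.cong (ℕ._+ m₂ x y) (varMonomial-self x y))) (P.trans (eq x y) m₀)
      ...   | ()

  signᶜ : ℕ → Carrier
  signᶜ zero = 1#
  signᶜ (suc zero) = - 1#
  signᶜ (suc (suc k)) = signᶜ k

  signᶜ-suc : ∀ k → signᶜ (suc k) ≈ - signᶜ k
  signᶜ-suc zero = refl
  signᶜ-suc (suc zero) = sym (-‿involutive 1#)
  signᶜ-suc (suc (suc k)) = signᶜ-suc k

  signᶜ≉0 : ∀ k → ¬ (signᶜ k ≈ 0#)
  signᶜ≉0 zero 1≈0 = 1≉0 1≈0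
  signᶜ≉0 (suc zero) -1≈0 = 1≉0 (begin
    1#        ≈⟨ sym (-‿involutive 1#) ⟩
    - (- 1#)  ≈⟨ -‿cong -1≈0 ⟩
    - 0#      ≈⟨ sym (trans (sym (-‿inverseˡ 0#)) (+-identityʳ (- 0#))) ⟩
    0#        ∎)
  signᶜ≉0 (suc (suc k)) = signᶜ≉0 k

  coefficient-sign* : ∀ m k X → coefficient m (sign k R.* X) ≈ signᶜ k * coefficient m X
  coefficient-sign* m zero X =
    trans (coefficient-cong m (R.trans (R.*-cong sign-zero R.refl) (R.*-identityˡ X))) (sym (*-identityˡ _))
  coefficient-sign* m (suc k) X = begin
    coefficient m (sign (suc k) R.* X)   ≈⟨ coefficient-cong m (R.trans (R.*-cong (sign-suc k) R.refl) (R.sym (R-neg-* (sign k) X))) ⟩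
    coefficient m (R.- (sign k R.* X))   ≈⟨ coefficient-neg m _ ⟩
    - coefficient m (sign k R.* X)       ≈⟨ -‿cong (coefficient-sign* m k X) ⟩
    - (signᶜ k * coefficient m X)        ≈⟨ -‿distribˡ-* _ _ ⟩
    - signᶜ k * coefficient m X          ≈⟨ *-cong (sym (signᶜ-suc k)) refl ⟩
    signᶜ (suc k) * coefficient m X      ∎
    where open import Algebra.Properties.Ring R.ring using () renaming (-‿distribˡ-* to R-neg-*)

  coefficient-∑-zero : ∀ m {s} (f : Fin s → Polynomial) → (∀ i → coefficient m (f i) ≈ 0#) → coefficient m (∑ f) ≈ 0#
  coefficient-∑-zero m {zero} f h = coefficient-cong m ∑-empty
  coefficient-∑-zero m {suc s} f h =
    trans (coefficient-cong m (∑-head f)) (trans (coefficient-+ m _ _)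
      (trans (+-cong (h Fin.zero) (coefficient-∑-zero m (λ i → f (Fin.suc i)) (λ i → h (Fin.suc i)))) (+-identityʳ 0#)))

  coefficient-∑-head : ∀ m {s} (f : Fin (suc s) → Polynomial) →
                       coefficient m (∑ f) ≈ coefficient m (f Fin.zero) + coefficient m (∑ (λ i → f (Fin.suc i)))
  coefficient-∑-head m f = trans (coefficient-cong m (∑-head f)) (coefficient-+ m _ _)

  coefficient-∑-last : ∀ m {s} (f : Fin (suc s) → Polynomial) →
                       coefficient m (∑ f) ≈ coefficient m (∑ (λ i → f (inject₁ i))) + coefficient m (f (fromℕ s))
  coefficient-∑-last m f = trans (coefficient-cong m (∑-last f)) (coefficient-+ m _ _)

  diagonal : ∀ {s} → (Fin s → Fin n) → (Fin s → Fin n) → Monomial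
  diagonal {zero} R C = oneMon
  diagonal {suc s} R C = varMonomial (R Fin.zero) (C Fin.zero) +ₘ diagonal (λ r → R (Fin.suc r)) (λ r → C (Fin.suc r))

  diagonal-otherRow : ∀ {s} (R C : Fin s → Fin n) x y → (∀ r → R r ≢ x) → diagonal R C x y ≡ 0
  diagonal-otherRow {zero} R C x y R≢x = P.refl
  diagonal-otherRow {suc s} R C x y R≢x =
    P.cong₂ ℕ._+_ (varMonomial-otherRow (R Fin.zero) (C Fin.zero) x y (λ eq → R≢x Fin.zero (P.sym eq)))
                  (diagonal-otherRow (λ r → R (Fin.suc r)) (λ r → C (Fin.suc r)) x y (λ r → R≢x (Fin.suc r)))

  increasing-injective : ∀ {s} (R : Fin s → Fin n) → StrictlyIncreasing R → ∀ r r' → toℕ r ℕ.< toℕ r' → R r ≢ R r'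
  increasing-injective R inc r r' lt eq = ℕP.<-irrefl (P.cong toℕ eq) (inc r r' lt)

  -- Only the first term of the first-row expansion contains the diagonal monomial.
  coefficient-diagonal : ∀ s (R C : Fin s → Fin n) → StrictlyIncreasing R → StrictlyIncreasing C →
                         coefficient (diagonal R C) (minor s R C) ≈ 1#
  coefficient-diagonal zero R C incR incC = coefficient-1
  coefficient-diagonal (suc s) R C incR incC = begin
    coefficient d (minor (suc s) R C)                         ≈⟨ coefficient-cong d (det-expandFirstRow s M) ⟩
    coefficient d (∑ T)                                       ≈⟨ coefficient-∑-head d T ⟩
    coefficient d (T Fin.zero) + coefficient d (∑ (λ i → T (Fin.suc i)))
      ≈⟨ +-cong (trans (coefficient-sign* d 0 _) (*-cong refl (coefficient-var*-divisible d _ _ _ _ (λ i j → P.refl))))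
                (coefficient-∑-zero d _ offDiagonal) ⟩
    1# * coefficient (diagonal R⁺ C⁺) (minor s R⁺ C⁺) + 0#   ≈⟨ +-cong (trans (*-identityˡ _) (coefficient-diagonal s R⁺ C⁺ incR⁺ incC⁺)) refl ⟩
    1# + 0#                                                   ≈⟨ +-identityʳ 1# ⟩
    1#                                                        ∎
    where
      d = diagonal R C
      R⁺ C⁺ : Fin s → Fin n
      R⁺ r = R (Fin.suc r)
      C⁺ r = C (Fin.suc r)
      incR⁺ : StrictlyIncreasing R⁺
      incR⁺ r r' lt = incR _ _ (ℕ.s≤s lt)
      incC⁺ : StrictlyIncreasing C⁺
      incC⁺ r r' lt = incC _ _ (ℕ.s≤s lt)
      M : Matrix (suc s)
      M r c' = var (R r) (C c')
      T : Fin (suc s) → Polynomial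
      T j = sign (toℕ j) R.* (M Fin.zero j R.* det s (λ r s' → M (Fin.suc r) (punchIn j s')))
      offDiagonal : ∀ u → coefficient d (T (Fin.suc u)) ≈ 0#
      offDiagonal u = trans (coefficient-sign* d _ _) (trans (*-cong refl (coefficient-var*-absent d _ _ _
        (P.cong₂ ℕ._+_
          (varMonomial-otherColumn (R Fin.zero) (C Fin.zero) _ _
            (λ eq → increasing-injective C incC Fin.zero (Fin.suc u) (ℕ.s≤s ℕ.z≤n) (P.sym eq)))
          (diagonal-otherRow R⁺ C⁺ _ _ (λ r eq → increasing-injective R incR Fin.zero (Fin.suc r) (ℕ.s≤s ℕ.z≤n) (P.sym eq))))))
        (zeroʳ _))

  -- Expanding along the last row, the monomial z_{R(s),C(s)} times the diagonal of the
  -- remaining minor only occurs in the last term, with coefficient ±1.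
  minor-hasCornerTerm : ∀ s (R C : Fin (suc s) → Fin n) → StrictlyIncreasing R → StrictlyIncreasing C →
                        ¬ NoTermDivisibleBy (R (fromℕ s)) (C (fromℕ s)) (minor (suc s) R C)
  minor-hasCornerTerm s R C incR incC noTerm = signᶜ≉0 (s ℕ.+ toℕ L) (trans (sym value) vanishes)
    where
      L = fromℕ s
      R⁻ C⁻ : Fin s → Fin n
      R⁻ r = R (inject₁ r)
      C⁻ r = C (inject₁ r)
      m : Monomial
      m = varMonomial (R L) (C L) +ₘ diagonal R⁻ C⁻
      M : Matrix (suc s)
      M r c' = var (R r) (C c')
      T : Fin (suc s) → Polynomial
      T t = sign (s ℕ.+ toℕ t) R.* (M L t R.* det s (λ a' b' → M (inject₁ a') (punchIn t b')))
      inject₁<L : ∀ r → toℕ (inject₁ r) ℕ.< toℕ L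
      inject₁<L r = P.subst₂ ℕ._<_ (P.sym (FinP.toℕ-inject₁ r)) (P.sym (FinP.toℕ-fromℕ s)) (FinP.toℕ<n r)
      vanishes : coefficient m (minor (suc s) R C) ≈ 0#
      vanishes = trans (sym (coeff≈⟦⟧indicator (minor (suc s) R C) m))
        (noTerm m (P.subst (1 ℕ.≤_) (P.sym (P.cong (ℕ._+ diagonal R⁻ C⁻ (R L) (C L)) (varMonomial-self (R L) (C L)))) (ℕ.s≤s ℕ.z≤n)))
      otherTerm : ∀ t → coefficient m (T (inject₁ t)) ≈ 0#
      otherTerm t = trans (coefficient-sign* m _ _) (trans (*-cong refl (coefficient-var*-absent m _ _ _
        (P.cong₂ ℕ._+_ (varMonomial-otherColumn (R L) (C L) (R L) (C (inject₁ t)) (increasing-injective C incC (inject₁ t) L (inject₁<L t)))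
                       (diagonal-otherRow R⁻ C⁻ (R L) _ (λ r → increasing-injective R incR (inject₁ r) L (inject₁<L r)))))) (zeroʳ _))
      lastTerm : coefficient m (T L) ≈ signᶜ (s ℕ.+ toℕ L) * 1#
      lastTerm = trans (coefficient-sign* m _ _) (*-cong refl (begin
        coefficient m (M L L R.* det s (λ a' b' → M (inject₁ a') (punchIn L b')))
          ≈⟨ coefficient-var*-divisible m (R L) (C L) (diagonal R⁻ C⁻) _ (λ i j → P.refl) ⟩
        coefficient (diagonal R⁻ C⁻) (det s (λ a' b' → M (inject₁ a') (punchIn L b')))
          ≈⟨ coefficient-cong (diagonal R⁻ C⁻) (det-cong s (λ a' b' → R.reflexive (P.cong (λ z → var (R⁻ a') (C z)) (punchIn-fromℕ b')))) ⟩
        coefficient (diagonal R⁻ C⁻) (minor s R⁻ C⁻)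
          ≈⟨ coefficient-diagonal s R⁻ C⁻ (increasing-inject₁ R incR) (increasing-inject₁ C incC) ⟩
        1# ∎))
      value : coefficient m (minor (suc s) R C) ≈ signᶜ (s ℕ.+ toℕ L)
      value = begin
        coefficient m (minor (suc s) R C)  ≈⟨ coefficient-cong m (det-expandLastRow s M) ⟩
        coefficient m (∑ T)                ≈⟨ coefficient-∑-last m T ⟩
        coefficient m (∑ (λ i → T (inject₁ i))) + coefficient m (T L)
          ≈⟨ +-cong (coefficient-∑-zero m _ otherTerm) lastTerm ⟩
        0# + signᶜ (s ℕ.+ toℕ L) * 1#      ≈⟨ trans (+-identityˡ _) (*-identityʳ _) ⟩
        signᶜ (s ℕ.+ toℕ L)                ∎

  -- p avoids z_{a,b} when its value under a functional ignores the functional's values on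
  -- monomials divisible by z_{a,b}; unlike NoTermDivisibleBy, this is closed under the
  -- ring operations.
  Avoids : Fin n → Fin n → Polynomial → Set (c ⊔ ℓ)
  Avoids a b p = ∀ G G' → Respects≗ₘ G → Respects≗ₘ G' → (∀ m → m a b ≡ 0 → G m ≈ G' m) → ⟦ p ⟧ G ≈ ⟦ p ⟧ G'

  module _ (a b : Fin n) where
    avoids-cong : ∀ {p q} → p R.≈ q → Avoids a b q → Avoids a b p
    avoids-cong p∼q h G G' RG RG' G≈G' = trans (run p∼q G RG) (trans (h G G' RG RG' G≈G') (sym (run p∼q G' RG')))

    avoids-+ : ∀ {p q} → Avoids a b p → Avoids a b q → Avoids a b (p R.+ q)
    avoids-+ {p} {q} hp hq G G' RG RG' G≈G' rewrite ⊕≡+ₚ p q =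
      trans (⟦++⟧ p q G) (trans (+-cong (hp G G' RG RG' G≈G') (hq G G' RG RG' G≈G')) (sym (⟦++⟧ p q G')))

    avoids-neg : ∀ {p} → Avoids a b p → Avoids a b (R.- p)
    avoids-neg {p} hp G G' RG RG' G≈G' rewrite ⊖≡-ₚ p =
      trans (⟦-ₚ⟧ p G) (trans (-‿cong (hp G G' RG RG' G≈G')) (sym (⟦-ₚ⟧ p G')))

    avoids-* : ∀ {p q} → Avoids a b p → Avoids a b q → Avoids a b (p R.* q)
    avoids-* {p} {q} hp hq G G' RG RG' G≈G' rewrite ⊗≡*ₚ p q =
      trans (⟦*ₚ⟧ p q G) (trans (hp _ _ (respects-⟦⟧-shift RG q) (respects-⟦⟧-shift RG' q)
        (λ m₁ m₁₀ → hq _ _ (respects-shift RG m₁) (respects-shift RG' m₁)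
          (λ m₂ m₂₀ → G≈G' (m₁ +ₘ m₂) (P.cong₂ ℕ._+_ m₁₀ m₂₀))))
        (sym (⟦*ₚ⟧ p q G')))

    avoids-1 : Avoids a b 1ₚ
    avoids-1 G G' RG RG' G≈G' = +-cong (*-cong refl (G≈G' oneMon P.refl)) refl

    avoids-sign : ∀ k → Avoids a b (sign k)
    avoids-sign zero = avoids-cong sign-zero avoids-1
    avoids-sign (suc k) = avoids-cong (sign-suc k) (avoids-neg (avoids-sign k))

    avoids-var : ∀ x y → x ≢ a ⊎ y ≢ b → Avoids a b (var x y)
    avoids-var x y ≢ab G G' RG RG' G≈G' = +-cong (*-cong refl (G≈G' (varMonomial x y) (absent ≢ab))) refl
      where
        absent : x ≢ a ⊎ y ≢ b → varMonomial x y a b ≡ 0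
        absent (inj₁ x≢a) = varMonomial-otherRow x y a b (λ eq → x≢a (P.sym eq))
        absent (inj₂ y≢b) = varMonomial-otherColumn x y a b (λ eq → y≢b (P.sym eq))

    avoids-∑ : ∀ {s} (f : Fin s → Polynomial) → (∀ i → Avoids a b (f i)) → Avoids a b (∑ f)
    avoids-∑ {zero} f h = avoids-cong ∑-empty (λ G G' RG RG' G≈G' → refl)
    avoids-∑ {suc s} f h = avoids-cong (∑-head f) (avoids-+ (h Fin.zero) (avoids-∑ (λ i → f (Fin.suc i)) (λ i → h (Fin.suc i))))

    avoids-det : ∀ k (M : Matrix k) → (∀ r s → Avoids a b (M r s)) → Avoids a b (det k M)
    avoids-det zero M h = avoids-1
    avoids-det (suc k) M h = avoids-cong (det-expandFirstRow k M)
      (avoids-∑ _ (λ j → avoids-* (avoids-sign _) (avoids-* (h Fin.zero j) (avoids-det k _ (λ r s → h (Fin.suc r) (punchIn j s))))))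

    avoids⇒noTermDivisibleBy : ∀ {p} → Avoids a b p → NoTermDivisibleBy a b p
    avoids⇒noTermDivisibleBy {p} hp m m≥1 =
      trans (coeff≈⟦⟧indicator p m) (trans (hp (indicator m) (λ _ → 0#) (indicator-respects m) (λ _ → refl) off) (⟦⟧-0 p))
      where
        off : ∀ m' → m' a b ≡ 0 → indicator m m' ≈ 0#
        off m' m'₀ with m' ≟ₘ m
        ... | no _ = refl
        ... | yes eq with P.subst (1 ℕ.≤_) (P.trans (P.sym (eq a b)) m'₀) m≥1
        ...   | ()

module CornerSwapIdeal {c ℓ : Level} (κ : Field c ℓ) (n : ℕ) (w : Permutation′ n) (a b : Fin n)
                       (corner : LowerOutsideCorner w a b) where
  open Poly κ n
  open Rank {n}
  open EssentialSet {n}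
  open CornerSwap w a b corner
  open Ideal κ n using (_∈ᴵ_; ∈ᴵ-gen; ∈ᴵ-trans)
  open Fulton κ n using (schubertGen∈ᴵfultonGen; IsNWMinor-widen; IsNWMinor-rank)
  open Coefficient κ n using (minor-hasCornerTerm; avoids-det; avoids-var; avoids⇒noTermDivisibleBy)

  H : Pred Polynomial (c ⊔ ℓ)
  H p = FultonGen w p × NoTermDivisibleBy a b p

  noTermDivisibleBy-northOrWest : ∀ {k} {i j : Fin n} {g} → NorthOrWest i j → IsNWMinor k i j g → NoTermDivisibleBy a b g
  noTermDivisibleBy-northOrWest {k} nw (R , C , _ , _ , R≤ , C≤ , P.refl) =
    avoids⇒noTermDivisibleBy a b {minor k R C} (avoids-det a b k (λ r s → var (R r) (C s)) (λ r s → avoids-var a b (R r) (C s) (avoidsCorner nw r s)))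
    where
      avoidsCorner : NorthOrWest _ _ → ∀ r s → R r ≢ a ⊎ C s ≢ b
      avoidsCorner (inj₁ i<a) r s = inj₁ (λ eq → ℕP.<⇒≱ i<a (P.subst (λ z → toℕ z ℕ.≤ _) eq (R≤ r)))
      avoidsCorner (inj₂ j<b) r s = inj₂ (λ eq → ℕP.<⇒≱ j<b (P.subst (λ z → toℕ z ℕ.≤ _) eq (C≤ s)))

  fultonGen-v⇒H : ∀ g → FultonGen v g → H g
  fultonGen-v⇒H g (i , j , (d , _) , nw) with essentialSE w i j (InD-v⇒InD-w i j d)
  ... | i' , j' , ess , i≤ , j≤ , rk≡ =
    (i' , j' , ess , IsNWMinor-rank (P.trans (rk-v≡rk-w i j nwᵢⱼ) (P.sym rk≡)) (IsNWMinor-widen nw i≤ j≤)) ,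
    noTermDivisibleBy-northOrWest nwᵢⱼ nw
    where nwᵢⱼ = InD-v⇒northOrWest i j d

  increasing-≤-last : ∀ {s} (R : Fin (suc s) → Fin n) → StrictlyIncreasing R → ∀ r → toℕ (R r) ℕ.≤ toℕ (R (fromℕ s))
  increasing-≤-last R inc r with ℕP.m≤n⇒m<n∨m≡n (FinP.≤fromℕ r)
  ... | inj₁ r<last = ℕP.<⇒≤ (inc r _ r<last)
  ... | inj₂ r≡last = ℕP.≤-reflexive (P.cong (λ z → toℕ (R z)) (FinP.toℕ-injective r≡last))

  cornerMinor⇒schubertGen-v : ∀ {h} → NoTermDivisibleBy a b h → IsNWMinor (suc (rk w a b)) a b h → SchubertGen v h
  cornerMinor⇒schubertGen-v {h} noTerm (R , C , incR , incC , R≤a , C≤b , h≡)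
    with toℕ (R (fromℕ _)) ℕP.<? toℕ a | toℕ (C (fromℕ _)) ℕP.<? toℕ b
  ... | yes lastRow<a | _ with predecessor lastRow<a
  ...   | a₀ , a≡ = a₀ , b , IsNWMinor-rank rank (R , C , incR , incC , R≤a₀ , C≤b , h≡)
    where
      R≤a₀ : ∀ r → toℕ (R r) ℕ.≤ toℕ a₀
      R≤a₀ r = ℕP.≤-pred (P.subst (_ ℕ.<_) a≡ (ℕP.≤-<-trans (increasing-≤-last R incR r) lastRow<a))
      rank : rk w a b ≡ rk v a₀ b
      rank = P.trans (rk-row-stable w a a₀ b a≡ b<q)
                     (P.sym (rk-v≡rk-w a₀ b (inj₁ (P.subst (toℕ a₀ ℕ.<_) (P.sym a≡) (ℕP.n<1+n _)))))
  cornerMinor⇒schubertGen-v {h} noTerm (R , C , incR , incC , R≤a , C≤b , h≡) | no _ | yes lastColumn<b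
    with predecessor lastColumn<b
  ... | b₀ , b≡ = a , b₀ , IsNWMinor-rank rank (R , C , incR , incC , R≤a , C≤b₀ , h≡)
    where
      C≤b₀ : ∀ s → toℕ (C s) ℕ.≤ toℕ b₀
      C≤b₀ s = ℕP.≤-pred (P.subst (_ ℕ.<_) b≡ (ℕP.≤-<-trans (increasing-≤-last C incC s) lastColumn<b))
      rank : rk w a b ≡ rk v a b₀
      rank = P.trans (rk-col-stable w a b b₀ b≡ a<p)
                     (P.sym (rk-v≡rk-w a b₀ (inj₂ (P.subst (toℕ b₀ ℕ.<_) (P.sym b≡) (ℕP.n<1+n _)))))
  cornerMinor⇒schubertGen-v {h} noTerm (R , C , incR , incC , R≤a , C≤b , P.refl) | no lastRow≮a | no lastColumn≮b =
    ⊥-elim (minor-hasCornerTerm _ R C incR incC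
      (P.subst₂ (λ x y → NoTermDivisibleBy x y h) (P.sym lastRow≡a) (P.sym lastColumn≡b) noTerm))
    where
      lastRow≡a = FinP.toℕ-injective (ℕP.≤-antisym (R≤a _) (ℕP.≮⇒≥ lastRow≮a))
      lastColumn≡b = FinP.toℕ-injective (ℕP.≤-antisym (C≤b _) (ℕP.≮⇒≥ lastColumn≮b))

  H⇒schubertGen-v : ∀ h → H h → SchubertGen v h
  H⇒schubertGen-v h ((i , j , ess , nw) , noTerm) with northOrWest? i j
  ... | inj₁ nwᵢⱼ = i , j , IsNWMinor-rank (P.sym (rk-v≡rk-w i j nwᵢⱼ)) nw
  ... | inj₂ (a≤i , b≤j) with cornerOf i j (proj₁ ess) a≤i b≤j
  ...   | P.refl , P.refl = cornerMinor⇒schubertGen-v noTerm nw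

  schubertGen-v∈ᴵH : ∀ g → SchubertGen v g → g ∈ᴵ H
  schubertGen-v∈ᴵH g Sg = ∈ᴵ-trans (λ g' Fg' → ∈ᴵ-gen H (fultonGen-v⇒H g' Fg')) (schubertGen∈ᴵfultonGen v g Sg)

lemma4p2 : ∀ {c ℓ} (κ : Field c ℓ) (n : ℕ) (w : Permutation′ n) (a b : Fin n)
    → LowerOutsideCorner w a b
    → let open Poly κ n
          v = swapPositions w a (w ⟨$⟩ˡ b)
          -- the Fulton generators h_1,…,h_ℓ of I_w in which y = z_{a,b} does not occur
          H = λ p → FultonGen w p × NoTermDivisibleBy a b p
      in (H ≐ᵢ SchubertGen v)
         × (∀ g → FultonGen v g → ∃[ h ] (H h × g ≈ₚ h))
lemma4p2 κ n w a b corner =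
    (λ p → ∈⟨⟩-mono H⇒schubertGen-v p , ∈⟨⟩-trans schubertGen-v∈ᴵH p)
  , (λ g Fg → g , fultonGen-v⇒H g Fg , λ _ → Field.refl κ)
  where
    open CornerSwapIdeal κ n w a b corner
    open Ideal κ n using (∈⟨⟩-mono; ∈⟨⟩-trans)
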